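{- (Swapping Lemma) Let $n\ge1$, $I\subseteq\{0,\dots,n-1\}$, $k\in\{1,\dots,n\}$, $w\in C_n^{I^c}$ and $x\in\mathrm{Swap}^k(w)$. Then $L(w)=L(\mathrm{swap}_x(w))$ and $\mathrm{sgn}(w)=-\mathrm{sgn}(\mathrm{swap}_x(w))$.
   Context: $B_n$ is the group of bijections $w$ of $\{ -n,\dots,n\}$ with $w(-i)=-w(i)$; $l(w)$ is the Coxeter length with respect to $s_0=[-1,2,\dots,n]$ and the adjacent transpositions $s_i$, and $\mathrm{sgn}(w)=(-1)^{l(w)}$ (equivalently the determinant of the signed permutation matrix). $L(w)=\frac12|\{(i,j)\in\{ -n,\dots,n\}^2:i<j,\ w(i)>w(j),\ i\not\equiv j\pmod 2\}|$. $D(w)=\{i\in\{0,\dots,n-1\}:w(i)>w(i+1)\}$ with $w(0)=0$; $C_n=\{w:|w(j)|\equiv j\pmod2\ \forall j\}$; $C_n^{I^c}=\{w\in C_n:D(w)\subseteq I\}$. The signed permutation matrix has $w_{i,j}=1$ if $w(j)=i$, $-1$ if $w(j)=-i$, $0$ otherwise; $i(t)=|w(t)|$ for a column $t$; $j(s)$ is the column of the nonzero entry of row $s$. Fix a column $k$. A sign swap is $(t)$ with $t\in[n]$ even, $t\le k$, and $j(s)>k$ for every row $s<i(t)$; $\mathrm{swap}_{(t)}(w)$ changes the sign of the entry in column $t$. A two swap is $(b,t)$ with $1\le b<t\le n$, $b\equiv t\pmod2$, and $j(s)>k$ for every row $s$ strictly between $i(b)$ and $i(t)$; $\mathrm{swap}_{(b,t)}(w)$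 interchanges rows $i(b)$ and $i(t)$ (entries keep their signs). A two swap $(b,t)$ is: a left swap if $t\le k$; a double-minus swap if $w_{i(b),b}=w_{i(t),t}=-1$, $k<b<t$, and $w_{s,j(s)}=1$ for all rows $s$ strictly between $i(b),i(t)$; a single-minus swap if $w_{i(t),t}=-1$, $b\le k<t$, and $w_{s,j(s)}=1$ for all rows strictly between; a double-plus swap if $w_{i(b),b}=w_{i(t),t}=1$, $k<b<t$, and $w_{s,j(s)}=-1$ for all rows strictly between; a single-plus swap if $w_{i(t),t}=1$, $b\le k<t$, and $w_{s,j(s)}=-1$ for all rows strictly between. $\mathrm{Swap}^k(w)$ is the set of all these swaps. -}

module Defs where

open import Data.Bool using (Bool; true; false; _∧_; not)
open import Data.Nat as ℕ using (ℕ; zero; suc; _≤_; _<_; _%_; _/_)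
open import Data.Nat.Properties using ()
open import Data.Integer as ℤ using (ℤ; +_; -[1+_]; ∣_∣)
open import Data.Integer.DivMod using (_%ℕ_)
open import Data.List using (List; []; _∷_; map; upTo; concatMap)
open import Data.Product using (_×_; _,_)
open import Relation.Nullary using (¬_)
open import Relation.Nullary.Decidable using (⌊_⌋)
open import Relation.Binary.PropositionalEquality using (_≡_; _≢_)

-- An element w ∈ B_n is encoded by its values on positions 1..n,
-- as a function ℕ → ℤ (values at positions outside 1..n are irrelevant).
-- w is a bijection of {-n..n} with w(-i) = -w(i) iff
-- j ↦ |w(j)| is a bijection of {1..n}.

SPerm : Set
SPerm = ℕ → ℤ

InRange : ℕ → ℕ → Set
InRange n j = 1 ≤ j × j ≤ n

IsSignedPerm : ℕ → SPerm → Set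
IsSignedPerm n w =
  (∀ j → InRange n j → InRange n ∣ w j ∣) ×
  (∀ i j → InRange n i → InRange n j → ∣ w i ∣ ≡ ∣ w j ∣ → i ≡ j)

ext : SPerm → ℤ → ℤ
ext w (+ zero)    = + 0
ext w (+ suc j)   = w (suc j)
ext w -[1+ j ]    = ℤ.- w (suc j)

count : {A : Set} → (A → Bool) → List A → ℕ
count p []       = 0
count p (x ∷ xs) with p x
... | true  = suc (count p xs)
... | false = count p xs

pos : ℕ → List ℕ
pos n = map suc (upTo n)

symRange : ℕ → List ℤ
symRange n = map (λ m → (+ m) ℤ.- (+ n)) (upTo (suc (n ℕ.+ n)))

pairs : {A : Set} → List A → List (A × A)
pairs xs = concatMap (λ x → map (λ y → (x , y)) xs) xs

-- Coxeter length of B_n (generators s_0 = [-1,2,...,n], s_i adjacent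
-- transpositions), via Björner–Brenti, Prop. 8.1.1:
--   l(w) = inv(w(1),...,w(n)) + nsp(w),
--   inv = #{1 ≤ i < j ≤ n : w(i) > w(j)},
--   nsp = #{1 ≤ i ≤ j ≤ n : w(i) + w(j) < 0}.

invB : ℕ → SPerm → ℕ
invB n w = count (λ { (i , j) → ⌊ i ℕ.<? j ⌋ ∧ ⌊ w j ℤ.<? w i ⌋ }) (pairs (pos n))

nsp : ℕ → SPerm → ℕ
nsp n w = count (λ { (i , j) → ⌊ i ℕ.≤? j ⌋ ∧ ⌊ w i ℤ.+ w j ℤ.<? + 0 ⌋ }) (pairs (pos n))

len : ℕ → SPerm → ℕ
len n w = invB n w ℕ.+ nsp n w

sgn : ℕ → SPerm → ℤ
sgn n w = (ℤ.- (+ 1)) ℤ.^ len n w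

Lstat : ℕ → SPerm → ℕ
Lstat n w =
  count (λ { (i , j) → ⌊ i ℤ.<? j ⌋ ∧ ⌊ ext w j ℤ.<? ext w i ⌋
                        ∧ not ⌊ (i %ℕ 2) ℕ.≟ (j %ℕ 2) ⌋ })
        (pairs (symRange n)) / 2

DescentsIn : ℕ → (ℕ → Set) → SPerm → Set
DescentsIn n I w = ∀ i → i < n → ext w (+ suc i) ℤ.< ext w (+ i) → I i

InC : ℕ → SPerm → Set
InC n w = ∀ j → InRange n j → ∣ w j ∣ % 2 ≡ j % 2

InCI : ℕ → (ℕ → Set) → SPerm → Set
InCI n I w = IsSignedPerm n w × InC n w × DescentsIn n I w

-- Rows of the signed permutation matrix are 1..n; column t has
-- its nonzero entry in row i(t) = |w(t)| with sign = sign of w(t).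
-- "for every row s with property P(s), j(s) > k" is expressed as
-- "for every column c ∈ [1,n] with P(i(c)), c > k" (j is the inverse
-- bijection of i).

StrictlyBetween : ℕ → ℕ → ℕ → Set
StrictlyBetween a b s = (a < s × s < b) Data.Sum.⊎ (b < s × s < a)
  where import Data.Sum

Pos Neg : ℤ → Set
Pos z = + 0 ℤ.< z
Neg z = z ℤ.< + 0

SignSwapCond : ℕ → ℕ → SPerm → ℕ → Set
SignSwapCond n k w t =
  InRange n t × t % 2 ≡ 0 × t ≤ k ×
  (∀ c → InRange n c → ∣ w c ∣ < ∣ w t ∣ → k < c)

TwoSwapCond : ℕ → ℕ → SPerm → ℕ → ℕ → Set
TwoSwapCond n k w b t =
  1 ≤ b × b < t × t ≤ n × b % 2 ≡ t % 2 ×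
  (∀ c → InRange n c → StrictlyBetween (∣ w b ∣) (∣ w t ∣) (∣ w c ∣) → k < c)

BetweenSigns : ℕ → (ℤ → Set) → SPerm → ℕ → ℕ → Set
BetweenSigns n P w b t =
  ∀ c → InRange n c → StrictlyBetween (∣ w b ∣) (∣ w t ∣) (∣ w c ∣) → P (w c)

data Swap (n k : ℕ) (w : SPerm) : Set where
  signSwap   : (t : ℕ) → SignSwapCond n k w t → Swap n k w
  leftSwap   : (b t : ℕ) → TwoSwapCond n k w b t → t ≤ k → Swap n k w
  doubleMinus : (b t : ℕ) → TwoSwapCond n k w b t →
                Neg (w b) → Neg (w t) → k < b → BetweenSigns n Pos w b t → Swap n k w
  singleMinus : (b t : ℕ) → TwoSwapCond n k w b t →
                Neg (w t) → b ≤ k → k < t → BetweenSigns n Pos w b t → Swap n k w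
  doublePlus  : (b t : ℕ) → TwoSwapCond n k w b t →
                Pos (w b) → Pos (w t) → k < b → BetweenSigns n Neg w b t → Swap n k w
  singlePlus  : (b t : ℕ) → TwoSwapCond n k w b t →
                Pos (w t) → b ≤ k → k < t → BetweenSigns n Neg w b t → Swap n k w

withSignOf : ℤ → ℕ → ℤ
withSignOf (+ _)    m = + m
withSignOf -[1+ _ ] m = ℤ.- (+ m)

signSwapF : SPerm → ℕ → SPerm
signSwapF w t c with c ℕ.≟ t
... | Relation.Nullary.yes _ = ℤ.- w t
... | Relation.Nullary.no  _ = w c

twoSwapF : SPerm → ℕ → ℕ → SPerm
twoSwapF w b t c with c ℕ.≟ b | c ℕ.≟ t
... | Relation.Nullary.yes _ | _ = withSignOf (w b) ∣ w t ∣
... | Relation.Nullary.no _ | Relation.Nullary.yes _ = withSignOf (w t) ∣ w b ∣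
... | Relation.Nullary.no _ | Relation.Nullary.no _ = w c

swap : {n k : ℕ} {w : SPerm} → Swap n k w → SPerm
swap {w = w} (signSwap t _)               = signSwapF w t
swap {w = w} (leftSwap b t _ _)           = twoSwapF w b t
swap {w = w} (doubleMinus b t _ _ _ _ _)  = twoSwapF w b t
swap {w = w} (singleMinus b t _ _ _ _ _)  = twoSwapF w b t
swap {w = w} (doublePlus b t _ _ _ _ _)   = twoSwapF w b t
swap {w = w} (singlePlus b t _ _ _ _ _)   = twoSwapF w b t

{-# OPTIONS --safe #-}
-- Both len and the count behind L decompose over the positions 1..n. len w is the number of negative
-- entries plus, over all pairs of positions i < j, the number pairInv of type-B inversions of the
-- entries w i, w j; the count behind L is twice the number of negative entries at odd positions plus
-- twice pairInv summed over the pairs of positions of opposite parity. When ∣ w i ∣ ≠ ∣ w j ∣, pairInv is 1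
-- if the absolute values are inverted, and otherwise twice [the entry at max(i, j) is negative].
-- A sign swap at the even position t changes only the sign term of t, so len changes by one and L
-- stays; the pairs (t, c) keep their pairInv because every c < t has ∣ w c ∣ > ∣ w t ∣.
-- A two swap (b, t) keeps all signs and exchanges ∣ w b ∣ and ∣ w t ∣. The pair (b, t) changes its
-- absolute inversion, which flips the parity of len and is invisible to L as b ≡ t (mod 2). For any other
-- position c, the pairs (b, c) and (t, c) together keep their parity, and keep their value unless ∣ w c ∣
-- lies strictly between ∣ w b ∣ and ∣ w t ∣, where the sign conditions of the swap take over.

module Submission where

open import Defs
open import Data.Nat using (ℕ; _≤_; _<_)
open import Data.Integer using (-_)
open import Data.Product using (_×_)
open import Relation.Binary.PropositionalEquality using (_≡_)

open import Data.Bool using (Bool; true; false; _∧_; not; if_then_else_)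
open import Data.Bool.Properties using (∧-assoc; ∧-zeroʳ)
open import Data.Integer as ℤ using (ℤ; +_; -[1+_]; ∣_∣)
open import Data.Integer.DivMod using (_%ℕ_)
open import Data.Integer.Properties as ℤ
  using ([1+m]⊖[1+n]≡m⊖n; m-n≡m⊖n; ⊖-≥; ∣-i∣≡∣i∣; +∣i∣≡i⊎+∣i∣≡-i;
         neg-involutive; neg-mono-<; neg-cancel-<; -1*i≡-i)
open import Data.List using (List; []; _∷_; _++_; _∷ʳ_; map; concatMap; upTo; downFrom; applyUpTo)
open import Data.List.Membership.Propositional using (_∈_)
open import Data.List.Membership.Propositional.Properties using (∈-map⁺; ∈-map⁻; ∈-downFrom⁺; ∈-downFrom⁻; ∈-∃++)
open import Data.List.Properties using (map-++; map-∘; map-cong; reverse-upTo; map-upTo; map-applyUpTo; applyUpTo-∷ʳ)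
open import Data.List.Relation.Binary.Permutation.Propositional
  using (_↭_; ↭-refl; ↭-sym; ↭-trans; ↭-swap; prep; ↭⇒↭ₛ; module PermutationReasoning)
open import Data.List.Relation.Binary.Permutation.Propositional.Properties
  using (shift; ↭-reverse; ∷↭∷ʳ; ∈-resp-↭) renaming (map⁺ to ↭-map⁺)
import Data.List.Relation.Binary.Permutation.Setoid.Properties as PermSetoid
open import Data.List.Relation.Unary.Any using (here; there)
open import Data.List.Relation.Unary.Unique.Propositional using (Unique) renaming (tail to Unique-tail)
open import Data.List.Relation.Unary.Unique.Propositional.Properties
  using (downFrom⁺; Unique[x∷xs]⇒x∉xs) renaming (map⁺ to Unique-map⁺)
import Data.Nat as ℕ
open import Data.Nat using (zero; suc; _+_; _*_; _%_; _/_; z≤n; s≤s; parity)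
open import Data.Nat.DivMod using (m%n<n)
open import Data.Nat.ListAction using (sum)
open import Data.Nat.ListAction.Properties using (sum-++; sum-↭)
open import Data.Nat.Properties
  using (+-suc; +-comm; +-identityʳ; *-zeroʳ; +-commutativeSemigroup; m≤n+m; m+n∸n≡m; suc-injective;
         ≤-refl; ≤-trans; ≤-antisym; <-irrefl; <-asym; <-trans; <-≤-trans; <-cmp;
         <⇒≤; <⇒≢; <⇒≯; <⇒≱; ≮⇒≥; ≤∧≢⇒<)
open import Data.Nat.Tactic.RingSolver using (solve-∀)
open import Algebra.Properties.CommutativeSemigroup +-commutativeSemigroup using () renaming (interchange to +-interchange)
open import Data.Parity using (Parity; 0ℙ; 1ℙ; _⁻¹)
import Data.Parity as ℙ
open import Data.Parity.Properties using (+-homo-+; *-homo-*; ⁻¹-involutive)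
open import Data.Product using (_,_; proj₁; proj₂; ∃-syntax)
open import Data.Sum using (inj₁; inj₂)
open import Function using (_∘_)
open import Function.Bundles using (_⇔_; mk⇔)
import Relation.Binary.PropositionalEquality as ≡
open import Relation.Binary.PropositionalEquality
  using (_≢_; ≢-sym; refl; sym; trans; cong; cong₂; subst; subst₂; module ≡-Reasoning)
open import Relation.Binary.Definitions using (tri<; tri≈; tri>)
open import Relation.Nullary using (Dec; yes; no; ¬_; contradiction)
open import Relation.Nullary.Decidable using (⌊_⌋; isYes≗does; dec-true; dec-false; does-⇔)

private variable
  A B : Set

𝟙 : Bool → ℕ
𝟙 true  = 1
𝟙 false = 0

𝟙-∧ : ∀ p q → 𝟙 (p ∧ q) ≡ 𝟙 p * 𝟙 q
𝟙-∧ true  q = sym (+-identityʳ (𝟙 q))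
𝟙-∧ false q = refl

⌊⌋-true : (a? : Dec A) → A → ⌊ a? ⌋ ≡ true
⌊⌋-true a? a = trans (isYes≗does a?) (dec-true a? a)

⌊⌋-false : (a? : Dec A) → ¬ A → ⌊ a? ⌋ ≡ false
⌊⌋-false a? ¬a = trans (isYes≗does a?) (dec-false a? ¬a)

⌊⌋-⇔ : A ⇔ B → (a? : Dec A) (b? : Dec B) → ⌊ a? ⌋ ≡ ⌊ b? ⌋
⌊⌋-⇔ A⇔B a? b? = trans (isYes≗does a?) (trans (does-⇔ A⇔B a? b?) (sym (isYes≗does b?)))

⌊⌋-true⁻¹ : {a? : Dec A} → ⌊ a? ⌋ ≡ true → A
⌊⌋-true⁻¹ {a? = yes a} _ = a

⌊⌋-false⁻¹ : {a? : Dec A} → ⌊ a? ⌋ ≡ false → ¬ A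
⌊⌋-false⁻¹ {a? = no ¬a} _ = ¬a

⌊<?⌋-flip : ∀ {X Y} → X ≢ Y → ⌊ Y ℕ.<? X ⌋ ≡ not ⌊ X ℕ.<? Y ⌋
⌊<?⌋-flip {X} {Y} X≢Y with <-cmp X Y
... | tri< X<Y _ _ = trans (⌊⌋-false (Y ℕ.<? X) (<⇒≯ X<Y)) (cong not (sym (⌊⌋-true (X ℕ.<? Y) X<Y)))
... | tri≈ _ X≡Y _ = contradiction X≡Y X≢Y
... | tri> _ _ Y<X = trans (⌊⌋-true (Y ℕ.<? X) Y<X) (cong not (sym (⌊⌋-false (X ℕ.<? Y) (<⇒≯ Y<X))))

⌊<?⌋≢⇒strictlyBetween : ∀ {X Y Z} → Z ≢ X → Z ≢ Y → ⌊ X ℕ.<? Z ⌋ ≢ ⌊ Y ℕ.<? Z ⌋ → StrictlyBetween X Y Z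
⌊<?⌋≢⇒strictlyBetween {X} {Y} {Z} Z≢X Z≢Y sides≢ with X ℕ.<? Z | Y ℕ.<? Z
... | yes X<Z | no Y≮Z = inj₁ (X<Z , ≤∧≢⇒< (≮⇒≥ Y≮Z) Z≢Y)
... | no X≮Z  | yes Y<Z = inj₂ (Y<Z , ≤∧≢⇒< (≮⇒≥ X≮Z) Z≢X)
... | yes _   | yes _   = contradiction refl sides≢
... | no _    | no _    = contradiction refl sides≢

∑ : List A → (A → ℕ) → ℕ
∑ xs f = sum (map f xs)

syntax ∑ xs (λ x → e) = ∑[ x ∈ xs ] e

∑∑ : List A → (A → A → ℕ) → ℕ
∑∑ xs h = ∑[ x ∈ xs ] ∑[ y ∈ xs ] h x y

∑-cong : (xs : List A) {f g : A → ℕ} → (∀ {x} → x ∈ xs → f x ≡ g x) → ∑ xs f ≡ ∑ xs g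
∑-cong []       f≗g = refl
∑-cong (x ∷ xs) f≗g = cong₂ _+_ (f≗g (here refl)) (∑-cong xs (f≗g ∘ there))

∑-+ : (xs : List A) (f g : A → ℕ) → ∑[ x ∈ xs ] (f x + g x) ≡ ∑ xs f + ∑ xs g
∑-+ []       f g = refl
∑-+ (x ∷ xs) f g = trans (cong (λ s → f x + g x + s) (∑-+ xs f g)) (+-interchange (f x) (g x) _ _)

∑-↭ : {xs ys : List A} (f : A → ℕ) → xs ↭ ys → ∑ xs f ≡ ∑ ys f
∑-↭ f xs↭ys = sum-↭ (↭-map⁺ f xs↭ys)

∑-concatMap : (g : B → List A) (xs : List B) (f : A → ℕ) → ∑ (concatMap g xs) f ≡ ∑[ x ∈ xs ] ∑ (g x) f
∑-concatMap g []       f = refl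
∑-concatMap g (x ∷ xs) f = begin
  sum (map f (g x ++ concatMap g xs))        ≡⟨ cong sum (map-++ f (g x) _) ⟩
  sum (map f (g x) ++ map f (concatMap g xs)) ≡⟨ sum-++ (map f (g x)) _ ⟩
  ∑ (g x) f + ∑ (concatMap g xs) f           ≡⟨ cong (λ s → ∑ (g x) f + s) (∑-concatMap g xs f) ⟩
  ∑ (g x) f + ∑[ y ∈ xs ] ∑ (g y) f          ∎
  where open ≡-Reasoning

∑-parity : (xs : List A) {f g : A → ℕ} → (∀ {x} → x ∈ xs → parity (f x) ≡ parity (g x)) →
           parity (∑ xs f) ≡ parity (∑ xs g)
∑-parity []       _   = refl
∑-parity (x ∷ xs) {f} {g} f≡g = begin
  parity (f x + ∑ xs f)            ≡⟨ +-homo-+ (f x) _ ⟩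
  parity (f x) ℙ.+ parity (∑ xs f) ≡⟨ cong₂ ℙ._+_ (f≡g (here refl)) (∑-parity xs (f≡g ∘ there)) ⟩
  parity (g x) ℙ.+ parity (∑ xs g) ≡⟨ +-homo-+ (g x) _ ⟨
  parity (g x + ∑ xs g)            ∎
  where open ≡-Reasoning

count≡∑ : (p : A → Bool) (xs : List A) → count p xs ≡ ∑[ x ∈ xs ] 𝟙 (p x)
count≡∑ p []       = refl
count≡∑ p (x ∷ xs) with p x
... | true  = cong suc (count≡∑ p xs)
... | false = count≡∑ p xs

count-pairs : (p : A × A → Bool) (xs : List A) → count p (pairs xs) ≡ ∑∑ xs (λ x y → 𝟙 (p (x , y)))
count-pairs p xs = begin
  count p (pairs xs)                           ≡⟨ count≡∑ p (pairs xs) ⟩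
  ∑ (pairs xs) (𝟙 ∘ p)                         ≡⟨ ∑-concatMap (λ x → map (x ,_) xs) xs (𝟙 ∘ p) ⟩
  ∑[ x ∈ xs ] sum (map (𝟙 ∘ p) (map (x ,_) xs)) ≡⟨ ∑-cong xs (λ _ → cong sum (sym (map-∘ xs))) ⟩
  ∑∑ xs (λ x y → 𝟙 (p (x , y)))                ∎
  where open ≡-Reasoning

∑∑-cong : (xs : List A) {g h : A → A → ℕ} → (∀ {x y} → x ∈ xs → y ∈ xs → g x y ≡ h x y) →
          ∑∑ xs g ≡ ∑∑ xs h
∑∑-cong xs g≡h = ∑-cong xs (λ x∈ → ∑-cong xs (g≡h x∈))

∑∑-+ : (xs : List A) (g h : A → A → ℕ) → ∑∑ xs (λ x y → g x y + h x y) ≡ ∑∑ xs g + ∑∑ xs h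
∑∑-+ xs g h = trans (∑-cong xs (λ {x} _ → ∑-+ xs (g x) (h x))) (∑-+ xs _ _)

∑∑-↭ : {xs ys : List A} (h : A → A → ℕ) → xs ↭ ys → ∑∑ xs h ≡ ∑∑ ys h
∑∑-↭ {ys = ys} h xs↭ys = trans (∑-↭ _ xs↭ys) (∑-cong ys (λ {x} _ → ∑-↭ (h x) xs↭ys))

∑∑-cons : (x : A) (R : List A) (h : A → A → ℕ) →
          ∑∑ (x ∷ R) h ≡ h x x + ∑[ c ∈ R ] (h x c + h c x) + ∑∑ R h
∑∑-cons x R h = begin
  (h x x + ∑ R (h x)) + ∑[ c ∈ R ] (h c x + ∑ R (h c))
    ≡⟨ cong (λ s → h x x + ∑ R (h x) + s) (∑-+ R (λ c → h c x) _) ⟩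
  (h x x + ∑ R (h x)) + (∑[ c ∈ R ] h c x + ∑∑ R h)
    ≡⟨ regroup (h x x) _ _ _ ⟩
  h x x + (∑ R (h x) + ∑[ c ∈ R ] h c x) + ∑∑ R h
    ≡⟨ cong (λ s → h x x + s + ∑∑ R h) (∑-+ R (h x) _) ⟨
  h x x + ∑[ c ∈ R ] (h x c + h c x) + ∑∑ R h ∎
  where
  open ≡-Reasoning
  regroup : ∀ a b c d → (a + b) + (c + d) ≡ a + (b + c) + d
  regroup = solve-∀

∑∑-cons₂ : (x y : A) (R : List A) (h : A → A → ℕ) →
  ∑∑ (x ∷ y ∷ R) h ≡ (h x x + h y y + (h x y + h y x)) + ∑[ c ∈ R ] ((h x c + h c x) + (h y c + h c y)) + ∑∑ R h
∑∑-cons₂ x y R h = begin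
  ∑∑ (x ∷ y ∷ R) h
    ≡⟨ ∑∑-cons x (y ∷ R) h ⟩
  h x x + ((h x y + h y x) + Sx) + ∑∑ (y ∷ R) h
    ≡⟨ cong (λ s → h x x + ((h x y + h y x) + Sx) + s) (∑∑-cons y R h) ⟩
  h x x + ((h x y + h y x) + Sx) + (h y y + Sy + ∑∑ R h)
    ≡⟨ regroup (h x x) (h y y) (h x y + h y x) Sx Sy (∑∑ R h) ⟩
  (h x x + h y y + (h x y + h y x)) + (Sx + Sy) + ∑∑ R h
    ≡⟨ cong (λ s → h x x + h y y + (h x y + h y x) + s + ∑∑ R h) (∑-+ R _ _) ⟨
  (h x x + h y y + (h x y + h y x)) + ∑[ c ∈ R ] ((h x c + h c x) + (h y c + h c y)) + ∑∑ R h ∎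
  where
  open ≡-Reasoning
  Sx = ∑[ c ∈ R ] (h x c + h c x)
  Sy = ∑[ c ∈ R ] (h y c + h c y)
  regroup : ∀ a b c d e f → a + (c + d) + (b + e + f) ≡ (a + b + c) + (d + e) + f
  regroup = solve-∀

signed : List ℕ → List ℤ
signed = concatMap (λ i → + i ∷ - + i ∷ [])

∑-signed : (P : List ℕ) (f : ℤ → ℕ) → ∑ (signed P) f ≡ ∑[ i ∈ P ] (f (+ i) + f (- + i))
∑-signed P f = trans (∑-concatMap _ P f) (∑-cong P (λ {i} _ → cong (λ s → f (+ i) + s) (+-identityʳ _)))

∑∑-signed : (P : List ℕ) (h : ℤ → ℤ → ℕ) →
  ∑∑ (signed P) h ≡ ∑∑ P (λ i j → (h (+ i) (+ j) + h (+ i) (- + j)) + (h (- + i) (+ j) + h (- + i) (- + j)))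
∑∑-signed P h = begin
  ∑[ x ∈ signed P ] ∑ (signed P) (h x)
    ≡⟨ ∑-cong (signed P) (λ {x} _ → ∑-signed P (h x)) ⟩
  ∑[ x ∈ signed P ] ∑[ j ∈ P ] (h x (+ j) + h x (- + j))
    ≡⟨ ∑-signed P _ ⟩
  ∑[ i ∈ P ] (∑[ j ∈ P ] (h (+ i) (+ j) + h (+ i) (- + j)) + ∑[ j ∈ P ] (h (- + i) (+ j) + h (- + i) (- + j)))
    ≡⟨ ∑-cong P (λ _ → ∑-+ P _ _) ⟨
  ∑∑ P (λ i j → (h (+ i) (+ j) + h (+ i) (- + j)) + (h (- + i) (+ j) + h (- + i) (- + j))) ∎
  where open ≡-Reasoning

parity-double : ∀ m → parity (2 * m) ≡ 0ℙ
parity-double m = *-homo-* 2 m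

parity-double-+ : ∀ m k → parity (2 * m + k) ≡ parity k
parity-double-+ m k = trans (+-homo-+ (2 * m) k) (cong (ℙ._+ parity k) (parity-double m))

𝟙-parity-not : ∀ s → parity (𝟙 s) ≡ parity (𝟙 (not s)) ⁻¹
𝟙-parity-not true  = refl
𝟙-parity-not false = refl

parity-+-flip : ∀ a a′ b b′ → parity a ≡ parity a′ ⁻¹ → parity b ≡ parity b′ →
                parity (a + b) ≡ parity (a′ + b′) ⁻¹
parity-+-flip a a′ b b′ a-flip b-same = begin
  parity (a + b)                   ≡⟨ +-homo-+ a b ⟩
  parity a ℙ.+ parity b            ≡⟨ cong₂ ℙ._+_ a-flip b-same ⟩
  parity a′ ⁻¹ ℙ.+ parity b′       ≡⟨ ⁻¹-+ (parity a′) (parity b′) ⟩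
  (parity a′ ℙ.+ parity b′) ⁻¹     ≡⟨ cong _⁻¹ (+-homo-+ a′ b′) ⟨
  parity (a′ + b′) ⁻¹              ∎
  where
  open ≡-Reasoning
  ⁻¹-+ : ∀ p q → p ⁻¹ ℙ.+ q ≡ (p ℙ.+ q) ⁻¹
  ⁻¹-+ 0ℙ q = refl
  ⁻¹-+ 1ℙ q = sym (⁻¹-involutive q)

signOf : Parity → ℤ
signOf 0ℙ = + 1
signOf 1ℙ = -[1+ 0 ]

[-1]^≡signOf∘parity : ∀ m → (- + 1) ℤ.^ m ≡ signOf (parity m)
[-1]^≡signOf∘parity zero          = refl
[-1]^≡signOf∘parity (suc zero)    = refl
[-1]^≡signOf∘parity (suc (suc m)) = trans (-1*-1*i≡i _) ([-1]^≡signOf∘parity m)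
  where
  -1*-1*i≡i : ∀ i → - + 1 ℤ.* (- + 1 ℤ.* i) ≡ i
  -1*-1*i≡i i = trans (-1*i≡-i _) (trans (cong -_ (-1*i≡-i i)) (neg-involutive i))

sgn-flip : ∀ n w v → parity (len n w) ≡ parity (len n v) ⁻¹ → sgn n w ≡ - sgn n v
sgn-flip n w v flip = begin
  (- + 1) ℤ.^ len n w              ≡⟨ [-1]^≡signOf∘parity (len n w) ⟩
  signOf (parity (len n w))        ≡⟨ cong signOf flip ⟩
  signOf (parity (len n v) ⁻¹)     ≡⟨ signOf-⁻¹ (parity (len n v)) ⟩
  - signOf (parity (len n v))      ≡⟨ cong -_ ([-1]^≡signOf∘parity (len n v)) ⟨
  - (- + 1) ℤ.^ len n v            ∎
  where
  open ≡-Reasoning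
  signOf-⁻¹ : ∀ p → signOf (p ⁻¹) ≡ - signOf p
  signOf-⁻¹ 0ℙ = refl
  signOf-⁻¹ 1ℙ = refl

-- Listed downwards, so that positions (suc n) unfolds to suc n ∷ positions n.
positions : ℕ → List ℕ
positions n = map suc (downFrom n)

pos↭positions : ∀ n → pos n ↭ positions n
pos↭positions n = ↭-map⁺ suc (subst (upTo n ↭_) (reverse-upTo n) (↭-sym (↭-reverse (upTo n))))

∈-positions⁺ : ∀ {n i} → InRange n i → i ∈ positions n
∈-positions⁺ {i = suc m} (_ , m<n) = ∈-map⁺ suc (∈-downFrom⁺ m<n)

∈-positions⁻ : ∀ {n i} → i ∈ positions n → InRange n i
∈-positions⁻ i∈ with m , m∈ , refl ← ∈-map⁻ suc i∈ = s≤s z≤n , ∈-downFrom⁻ m∈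

positions-unique : ∀ n → Unique (positions n)
positions-unique n = Unique-map⁺ suc-injective (downFrom⁺ n)

symRange-suc : ∀ n → symRange (suc n) ≡ -[1+ n ] ∷ symRange n ∷ʳ + suc n
symRange-suc n = cong (-[1+ n ] ∷_) (begin
  map f (applyUpTo suc k)                           ≡⟨ map-applyUpTo suc f k ⟩
  applyUpTo (f ∘ suc) k                             ≡⟨ map-upTo (f ∘ suc) k ⟨
  map (f ∘ suc) (upTo k)                            ≡⟨ map-cong shift-down (upTo k) ⟩
  map g (upTo k)                                    ≡⟨ map-upTo g k ⟩
  applyUpTo g (suc (n + suc n))                     ≡⟨ cong (applyUpTo g ∘ suc) (+-suc n n) ⟩
  applyUpTo g (suc (suc (n + n)))                   ≡⟨ applyUpTo-∷ʳ g (suc (n + n)) ⟨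
  applyUpTo g (suc (n + n)) ∷ʳ g (suc (n + n))      ≡⟨ cong₂ _∷ʳ_ (map-upTo g (suc (n + n))) (sym top) ⟨
  symRange n ∷ʳ + suc n                             ∎)
  where
  open ≡-Reasoning
  f g : ℕ → ℤ
  f m = + m ℤ.- + suc n
  g m = + m ℤ.- + n
  k = suc (n + suc n)
  shift-down : ∀ m → f (suc m) ≡ g m
  shift-down m = trans ([1+m]⊖[1+n]≡m⊖n m n) (sym (m-n≡m⊖n m n))
  top : g (suc (n + n)) ≡ + suc n
  top = trans (m-n≡m⊖n (suc n + n) n) (trans (⊖-≥ (m≤n+m n (suc n))) (cong +_ (m+n∸n≡m (suc n) n)))

symRange↭ : ∀ n → symRange n ↭ + 0 ∷ signed (positions n)
symRange↭ zero    = ↭-refl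
symRange↭ (suc n) = begin
  symRange (suc n)                                  ≡⟨ symRange-suc n ⟩
  -[1+ n ] ∷ symRange n ∷ʳ + suc n                  ↭⟨ prep -[1+ n ] (↭-sym (∷↭∷ʳ (+ suc n) _)) ⟩
  -[1+ n ] ∷ + suc n ∷ symRange n                   ↭⟨ ↭-swap -[1+ n ] (+ suc n) (symRange↭ n) ⟩
  + suc n ∷ -[1+ n ] ∷ + 0 ∷ signed (positions n)   ↭⟨ shift (+ 0) (+ suc n ∷ -[1+ n ] ∷ []) _ ⟩
  + 0 ∷ signed (positions (suc n))                  ∎
  where open PermutationReasoning

Unique-resp-↭ : {xs ys : List A} → xs ↭ ys → Unique xs → Unique ys
Unique-resp-↭ xs↭ys = PermSetoid.Unique-resp-↭ (≡.setoid _) (↭⇒↭ₛ xs↭ys)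

∈⇒↭∷ : {x : A} {xs : List A} → x ∈ xs → ∃[ R ] xs ↭ x ∷ R
∈⇒↭∷ x∈xs with ys , zs , refl ← ∈-∃++ x∈xs = ys ++ zs , shift _ ys zs

∈⇒↭∷∷ : {x y : A} {xs : List A} → x ∈ xs → y ∈ xs → x ≢ y → ∃[ R ] xs ↭ x ∷ y ∷ R
∈⇒↭∷∷ x∈xs y∈xs x≢y with R₁ , xs↭ ← ∈⇒↭∷ x∈xs with ∈-resp-↭ xs↭ y∈xs
... | here y≡x     = contradiction (sym y≡x) x≢y
... | there y∈R₁ with R , R₁↭ ← ∈⇒↭∷ y∈R₁ = R , ↭-trans xs↭ (prep _ R₁↭)

∈-tail⇒≢ : {x c : A} {R : List A} → Unique (x ∷ R) → c ∈ R → c ≢ x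
∈-tail⇒≢ u c∈R refl = Unique[x∷xs]⇒x∉xs u c∈R

module _ {n : ℕ} where

  positions-split₁ : ∀ {t} → InRange n t →
    ∃[ R ] positions n ↭ t ∷ R × (∀ {c} → c ∈ R → InRange n c × c ≢ t)
  positions-split₁ t∈ with R , P↭ ← ∈⇒↭∷ (∈-positions⁺ t∈) =
    R , P↭ , λ c∈R → ∈-positions⁻ (∈-resp-↭ (↭-sym P↭) (there c∈R)) , ∈-tail⇒≢ unique c∈R
    where unique = Unique-resp-↭ P↭ (positions-unique n)

  positions-split₂ : ∀ {b t} → InRange n b → InRange n t → b ≢ t →
    ∃[ R ] positions n ↭ b ∷ t ∷ R × (∀ {c} → c ∈ R → InRange n c × c ≢ b × c ≢ t)
  positions-split₂ b∈ t∈ b≢t with R , P↭ ← ∈⇒↭∷∷ (∈-positions⁺ b∈) (∈-positions⁺ t∈) b≢t =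
    R , P↭ , λ c∈R → ∈-positions⁻ (∈-resp-↭ (↭-sym P↭) (there (there c∈R))) ,
                     ∈-tail⇒≢ unique (there c∈R) , ∈-tail⇒≢ (Unique-tail unique) c∈R
    where unique = Unique-resp-↭ P↭ (positions-unique n)

isNeg : ℤ → Bool
isNeg a = ⌊ a ℤ.<? + 0 ⌋

isNeg-neg : ∀ {a} → a ≢ + 0 → isNeg (- a) ≡ not (isNeg a)
isNeg-neg {+ zero}   a≢0 = contradiction refl a≢0
isNeg-neg {+ suc _}  _   = refl
isNeg-neg { -[1+ _ ]} _  = refl

isNeg-withSignOf : ∀ a {m} → m ≢ 0 → isNeg (withSignOf a m) ≡ isNeg a
isNeg-withSignOf (+ _)     _   = refl
isNeg-withSignOf -[1+ _ ] {zero}  m≢0 = contradiction refl m≢0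
isNeg-withSignOf -[1+ _ ] {suc _} _   = refl

∣withSignOf∣ : ∀ a m → ∣ withSignOf a m ∣ ≡ m
∣withSignOf∣ (+ _)     m = refl
∣withSignOf∣ -[1+ _ ] m = ∣-i∣≡∣i∣ (+ m)

isNeg-Neg : ∀ {z} → Neg z → isNeg z ≡ true
isNeg-Neg {z} z<0 = ⌊⌋-true (z ℤ.<? + 0) z<0

isNeg-Pos : ∀ {z} → Pos z → isNeg z ≡ false
isNeg-Pos {z} 0<z = ⌊⌋-false (z ℤ.<? + 0) (ℤ.<-asym 0<z)

⌊b<-a⌋≡⌊a<-b⌋ : ∀ a b → ⌊ b ℤ.<? - a ⌋ ≡ ⌊ a ℤ.<? - b ⌋
⌊b<-a⌋≡⌊a<-b⌋ a b = ⌊⌋-⇔ (mk⇔ flip flip) _ _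
  where
  flip : ∀ {x y} → y ℤ.< - x → x ℤ.< - y
  flip {x} y<-x = subst (ℤ._< _) (neg-involutive x) (neg-mono-< y<-x)

⌊-b<-a⌋≡⌊a<b⌋ : ∀ a b → ⌊ - b ℤ.<? - a ⌋ ≡ ⌊ a ℤ.<? b ⌋
⌊-b<-a⌋≡⌊a<b⌋ a b = ⌊⌋-⇔ (mk⇔ neg-cancel-< neg-mono-<) _ _

⌊a+b<0⌋≡⌊b<-a⌋ : ∀ a b → ⌊ a ℤ.+ b ℤ.<? + 0 ⌋ ≡ ⌊ b ℤ.<? - a ⌋
⌊a+b<0⌋≡⌊b<-a⌋ a b = ⌊⌋-⇔ (mk⇔ to from) _ _
  where
  to : a ℤ.+ b ℤ.< + 0 → b ℤ.< - a
  to a+b<0 = subst₂ ℤ._<_ (trans (sym (ℤ.+-assoc (- a) a b)) (trans (cong (ℤ._+ b) (ℤ.+-inverseˡ a)) (ℤ.+-identityˡ b)))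
                          (ℤ.+-identityʳ (- a)) (ℤ.+-monoʳ-< (- a) a+b<0)
  from : b ℤ.< - a → a ℤ.+ b ℤ.< + 0
  from b<-a = subst (a ℤ.+ b ℤ.<_) (ℤ.+-inverseʳ a) (ℤ.+-monoʳ-< a b<-a)

-- Entries a, b at positions i < j contribute [b < a] to inv and [a + b < 0] = [b < - a] to nsp.
pairInv : ℤ → ℤ → ℕ
pairInv a b = 𝟙 ⌊ b ℤ.<? a ⌋ + 𝟙 ⌊ b ℤ.<? - a ⌋

pairInv-neg : ∀ a b → pairInv (- a) b ≡ pairInv a b
pairInv-neg a b rewrite neg-involutive a = +-comm (𝟙 ⌊ b ℤ.<? - a ⌋) (𝟙 ⌊ b ℤ.<? a ⌋)

pairInv-abs : ∀ a b → pairInv (+ ∣ a ∣) b ≡ pairInv a b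
pairInv-abs a b with +∣i∣≡i⊎+∣i∣≡-i a
... | inj₁ ∣a∣≡a  = cong (λ x → pairInv x b) ∣a∣≡a
... | inj₂ ∣a∣≡-a = trans (cong (λ x → pairInv x b) ∣a∣≡-a) (pairInv-neg a b)

pairInv-∣b∣<∣a∣ : ∀ a b → ∣ b ∣ < ∣ a ∣ → pairInv a b ≡ 1
pairInv-∣b∣<∣a∣ a b b<a = begin
  pairInv a b
    ≡⟨ pairInv-abs a b ⟨
  𝟙 ⌊ b ℤ.<? + ∣ a ∣ ⌋ + 𝟙 ⌊ b ℤ.<? - + ∣ a ∣ ⌋
    ≡⟨ cong₂ (λ p q → 𝟙 p + 𝟙 q) (⌊⌋-true (b ℤ.<? _) (below b<a)) (⌊⌋-false (b ℤ.<? _) (above {b} b<a)) ⟩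
  1 ∎
  where
  open ≡-Reasoning
  below : ∀ {b m} → ∣ b ∣ < m → b ℤ.< + m
  below {+ _}      q<m = ℤ.+<+ q<m
  below { -[1+ _ ]} _  = ℤ.-<+
  above : ∀ {b m} → ∣ b ∣ < m → ¬ (b ℤ.< - + m)
  above {+ _}       {suc _} _          ()
  above { -[1+ _ ]} {suc _} (s≤s q<m) (ℤ.-<- m<q) = <-asym q<m m<q

pairInv-∣a∣<∣b∣ : ∀ a b → ∣ a ∣ < ∣ b ∣ → pairInv a b ≡ 2 * 𝟙 (isNeg b)
pairInv-∣a∣<∣b∣ a b a<b = begin
  pairInv a b
    ≡⟨ pairInv-abs a b ⟨
  𝟙 ⌊ b ℤ.<? + ∣ a ∣ ⌋ + 𝟙 ⌊ b ℤ.<? - + ∣ a ∣ ⌋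
    ≡⟨ cong₂ (λ p q → 𝟙 p + 𝟙 q) (⌊⌋-⇔ (below⇔neg {b} a<b) (b ℤ.<? _) (b ℤ.<? + 0))
                                 (⌊⌋-⇔ (above⇔neg {b} a<b) (b ℤ.<? _) (b ℤ.<? + 0)) ⟩
  𝟙 (isNeg b) + 𝟙 (isNeg b)
    ≡⟨ cong (λ s → 𝟙 (isNeg b) + s) (+-identityʳ _) ⟨
  2 * 𝟙 (isNeg b) ∎
  where
  open ≡-Reasoning
  below⇔neg : ∀ {b m} → m < ∣ b ∣ → b ℤ.< + m ⇔ b ℤ.< + 0
  below⇔neg {+ _}       m<q = mk⇔ (λ { (ℤ.+<+ q<m) → contradiction q<m (<-asym m<q) }) λ { (ℤ.+<+ ()) }
  below⇔neg { -[1+ _ ]} _   = mk⇔ (λ _ → ℤ.-<+) (λ _ → ℤ.-<+)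
  above⇔neg : ∀ {b m} → m < ∣ b ∣ → b ℤ.< - + m ⇔ b ℤ.< + 0
  above⇔neg {+ _}       {zero}  _         = mk⇔ (λ b<0 → b<0) (λ b<0 → b<0)
  above⇔neg {+ _}       {suc _} _         = mk⇔ (λ ()) λ { (ℤ.+<+ ()) }
  above⇔neg { -[1+ _ ]} {zero}  _         = mk⇔ (λ b<0 → b<0) (λ b<0 → b<0)
  above⇔neg { -[1+ _ ]} {suc _} (s≤s m<q) = mk⇔ (λ _ → ℤ.-<+) (λ _ → ℤ.-<- m<q)

pairInvAt : ℕ → ℕ → ℤ → ℤ → ℕ
pairInvAt i j a b = if ⌊ i ℕ.<? j ⌋ then pairInv a b else pairInv b a

pairInvAt-sym : ∀ {i j} a b → i ≢ j → pairInvAt j i b a ≡ pairInvAt i j a b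
pairInvAt-sym {i} {j} a b i≢j with i ℕ.<? j | j ℕ.<? i
... | yes i<j | yes j<i = contradiction j<i (<-asym i<j)
... | yes _   | no _    = refl
... | no _    | yes _   = refl
... | no i≮j  | no j≮i  = contradiction (≤-antisym (≮⇒≥ j≮i) (≮⇒≥ i≮j)) i≢j

pairInvAt-neg : ∀ i j a b → (¬ i < j → ∣ a ∣ < ∣ b ∣) → pairInvAt i j (- a) b ≡ pairInvAt i j a b
pairInvAt-neg i j a b later with i ℕ.<? j
... | yes _   = pairInv-neg a b
... | no i≮j  = trans (pairInv-∣b∣<∣a∣ b (- a) (subst (_< ∣ b ∣) (sym (∣-i∣≡∣i∣ a)) (later i≮j)))
                      (sym (pairInv-∣b∣<∣a∣ b a (later i≮j)))

pairInvShape : Bool → Bool → Bool → Bool → ℕ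
pairInvShape true  below _    negB = if below then 2 * 𝟙 negB else 1
pairInvShape false below negA _    = if below then 1 else 2 * 𝟙 negA

pairInvAt-shape : ∀ i j a b → ∣ a ∣ ≢ ∣ b ∣ →
  pairInvAt i j a b ≡ pairInvShape ⌊ i ℕ.<? j ⌋ ⌊ ∣ a ∣ ℕ.<? ∣ b ∣ ⌋ (isNeg a) (isNeg b)
pairInvAt-shape i j a b a≢b with ⌊ i ℕ.<? j ⌋ | ∣ a ∣ ℕ.<? ∣ b ∣
... | true  | yes a<b = pairInv-∣a∣<∣b∣ a b a<b
... | true  | no  a≮b = pairInv-∣b∣<∣a∣ a b (≤∧≢⇒< (≮⇒≥ a≮b) (≢-sym a≢b))
... | false | yes a<b = pairInv-∣b∣<∣a∣ b a a<b
... | false | no  a≮b = pairInv-∣a∣<∣b∣ b a (≤∧≢⇒< (≮⇒≥ a≮b) (≢-sym a≢b))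

pairInvShape-parity-flip : ∀ before below sa sb sa′ sb′ →
  parity (pairInvShape before below sa sb) ≡ parity (pairInvShape before (not below) sa′ sb′) ⁻¹
pairInvShape-parity-flip true  true  _  sb _   _   = parity-double (𝟙 sb)
pairInvShape-parity-flip true  false _  _  _   sb′ = sym (cong _⁻¹ (parity-double (𝟙 sb′)))
pairInvShape-parity-flip false true  _  _  sa′ _   = sym (cong _⁻¹ (parity-double (𝟙 sa′)))
pairInvShape-parity-flip false false sa _  _   _   = parity-double (𝟙 sa)

pairInvAt-exchange-parity : ∀ i j {a b a′ b′} → ∣ a ∣ ≢ ∣ b ∣ → ∣ a′ ∣ ≡ ∣ b ∣ → ∣ b′ ∣ ≡ ∣ a ∣ →
  parity (pairInvAt i j a b) ≡ parity (pairInvAt i j a′ b′) ⁻¹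
pairInvAt-exchange-parity i j {a} {b} {a′} {b′} a≢b a′≡b b′≡a = begin
  parity (pairInvAt i j a b)
    ≡⟨ cong parity (pairInvAt-shape i j a b a≢b) ⟩
  parity (pairInvShape ⌊ i ℕ.<? j ⌋ ⌊ ∣ a ∣ ℕ.<? ∣ b ∣ ⌋ (isNeg a) (isNeg b))
    ≡⟨ pairInvShape-parity-flip ⌊ i ℕ.<? j ⌋ ⌊ ∣ a ∣ ℕ.<? ∣ b ∣ ⌋ (isNeg a) (isNeg b) (isNeg a′) (isNeg b′) ⟩
  parity (pairInvShape ⌊ i ℕ.<? j ⌋ (not ⌊ ∣ a ∣ ℕ.<? ∣ b ∣ ⌋) (isNeg a′) (isNeg b′)) ⁻¹
    ≡⟨ cong (λ x → parity (pairInvShape ⌊ i ℕ.<? j ⌋ x (isNeg a′) (isNeg b′)) ⁻¹)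
            (trans (cong₂ (λ x y → ⌊ x ℕ.<? y ⌋) a′≡b b′≡a) (⌊<?⌋-flip a≢b)) ⟨
  parity (pairInvShape ⌊ i ℕ.<? j ⌋ ⌊ ∣ a′ ∣ ℕ.<? ∣ b′ ∣ ⌋ (isNeg a′) (isNeg b′)) ⁻¹
    ≡⟨ cong (λ m → parity m ⁻¹) (pairInvAt-shape i j a′ b′ (λ e → a≢b (trans (sym b′≡a) (trans (sym e) a′≡b)))) ⟨
  parity (pairInvAt i j a′ b′) ⁻¹
    ∎
  where open ≡-Reasoning

-- Read bc, tc as b < c, t < c and x, y as X < Z, Y < Z, where positions b < t exchange their absolute
-- values X ≠ Y, a third position c has absolute value Z, and the signs sb, st, sc stay.
pairInvShape-exchange : ∀ bc tc x y sb st sc → (bc ≡ false → tc ≡ false) →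
  (x ≢ y → (bc ≡ false → sb ≡ st) × (bc ≡ true → tc ≡ false → sc ≡ not st)) →
  pairInvShape bc x sb sc + pairInvShape tc y st sc ≡ pairInvShape bc y sb sc + pairInvShape tc x st sc
pairInvShape-exchange _     _     true  true  _  _  _  _ _ = refl
pairInvShape-exchange _     _     false false _  _  _  _ _ = refl
pairInvShape-exchange true  true  true  false _  _  sc _ _ = +-comm (2 * 𝟙 sc) 1
pairInvShape-exchange true  true  false true  _  _  sc _ _ = +-comm 1 (2 * 𝟙 sc)
pairInvShape-exchange false false true  false _  st _  _ h rewrite proj₁ (h (λ ())) refl = +-comm 1 (2 * 𝟙 st)
pairInvShape-exchange false false false true  _  st _  _ h rewrite proj₁ (h (λ ())) refl = +-comm (2 * 𝟙 st) 1
pairInvShape-exchange true  false true  false _  st _  _ h rewrite proj₂ (h (λ ())) refl refl = opposite st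
  where
  opposite : ∀ s → 2 * 𝟙 (not s) + 2 * 𝟙 s ≡ 1 + 1
  opposite true  = refl
  opposite false = refl
pairInvShape-exchange true  false false true  _  st _  _ h rewrite proj₂ (h (λ ())) refl refl = opposite st
  where
  opposite : ∀ s → 1 + 1 ≡ 2 * 𝟙 (not s) + 2 * 𝟙 s
  opposite true  = refl
  opposite false = refl
pairInvShape-exchange false true  true  false _  _  _  b≥c⇒t≥c _ = contradiction (b≥c⇒t≥c refl) λ ()
pairInvShape-exchange false true  false true  _  _  _  b≥c⇒t≥c _ = contradiction (b≥c⇒t≥c refl) λ ()

pairInvShape-exchange-parity : ∀ bc tc x y sb st sc → (bc ≡ false → tc ≡ false) →
  parity (pairInvShape bc x sb sc + pairInvShape tc y st sc) ≡ parity (pairInvShape bc y sb sc + pairInvShape tc x st sc)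
pairInvShape-exchange-parity _     _     true  true  _  _  _  _ = refl
pairInvShape-exchange-parity _     _     false false _  _  _  _ = refl
pairInvShape-exchange-parity true  true  true  false _  _  sc _ = cong parity (+-comm (2 * 𝟙 sc) 1)
pairInvShape-exchange-parity true  true  false true  _  _  sc _ = cong parity (+-comm 1 (2 * 𝟙 sc))
pairInvShape-exchange-parity false false true  false sb st _  _ =
  trans (cong parity (+-comm 1 (2 * 𝟙 st))) (trans (parity-double-+ (𝟙 st) 1) (sym (parity-double-+ (𝟙 sb) 1)))
pairInvShape-exchange-parity false false false true  sb st _  _ =
  trans (parity-double-+ (𝟙 sb) 1) (trans (sym (parity-double-+ (𝟙 st) 1)) (cong parity (+-comm (2 * 𝟙 st) 1)))
pairInvShape-exchange-parity true  false true  false _  st sc _ =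
  trans (parity-double-+ (𝟙 sc) (2 * 𝟙 st)) (parity-double (𝟙 st))
pairInvShape-exchange-parity true  false false true  _  st sc _ =
  sym (trans (parity-double-+ (𝟙 sc) (2 * 𝟙 st)) (parity-double (𝟙 st)))
pairInvShape-exchange-parity false true  true  false _  _  _  b≥c⇒t≥c = contradiction (b≥c⇒t≥c refl) λ ()
pairInvShape-exchange-parity false true  false true  _  _  _  b≥c⇒t≥c = contradiction (b≥c⇒t≥c refl) λ ()

oppositeParity : ℕ → ℕ → Bool
oppositeParity i j = not ⌊ i % 2 ℕ.≟ j % 2 ⌋

oppositeParity-sym : ∀ i j → oppositeParity i j ≡ oppositeParity j i
oppositeParity-sym i j = cong not (⌊⌋-⇔ (mk⇔ sym sym) (i % 2 ℕ.≟ j % 2) (j % 2 ℕ.≟ i % 2))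

oppositeParity-false : ∀ {i j} → i % 2 ≡ j % 2 → oppositeParity i j ≡ false
oppositeParity-false {i} {j} eq = cong not (⌊⌋-true (i % 2 ℕ.≟ j % 2) eq)

neg-%ℕ2 : ∀ i → (- + i) %ℕ 2 ≡ i % 2
neg-%ℕ2 zero    = refl
neg-%ℕ2 (suc m) with suc m % 2 | m%n<n (suc m) 2
... | 0           | _             = refl
... | 1           | _             = refl
... | suc (suc _) | s≤s (s≤s ())

lenKernel : ℕ → ℕ → ℤ → ℤ → ℕ
lenKernel i j a b = 𝟙 (⌊ i ℕ.<? j ⌋ ∧ ⌊ b ℤ.<? a ⌋) + 𝟙 (⌊ i ℕ.≤? j ⌋ ∧ ⌊ a ℤ.+ b ℤ.<? + 0 ⌋)

invKernel : ℤ → ℤ → ℤ → ℤ → ℕ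
invKernel x y a b = 𝟙 (⌊ x ℤ.<? y ⌋ ∧ ⌊ b ℤ.<? a ⌋)

LKernel : ℤ → ℤ → ℤ → ℤ → ℕ
LKernel x y a b = 𝟙 (⌊ x ℤ.<? y ⌋ ∧ ⌊ b ℤ.<? a ⌋ ∧ not ⌊ x %ℕ 2 ℕ.≟ y %ℕ 2 ⌋)

orbitSum : (ℤ → ℤ → ℤ → ℤ → ℕ) → ℕ → ℕ → ℤ → ℤ → ℕ
orbitSum K i j a b = (K (+ i) (+ j) a b + K (+ i) (- + j) a (- b))
                   + (K (- + i) (+ j) (- a) b + K (- + i) (- + j) (- a) (- b))

zeroSum : (ℤ → ℤ → ℤ → ℤ → ℕ) → ℕ → ℤ → ℕ
zeroSum K i a = (K (+ 0) (+ i) (+ 0) a + K (+ i) (+ 0) a (+ 0))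
              + (K (+ 0) (- + i) (+ 0) (- a) + K (- + i) (+ 0) (- a) (+ 0))

lenKernel-diag : ∀ i a → lenKernel i i a a ≡ 𝟙 (isNeg a)
lenKernel-diag i a rewrite ⌊⌋-false (i ℕ.<? i) (<-irrefl refl) | ⌊⌋-true (i ℕ.≤? i) ≤-refl = cong 𝟙 (double-neg a)
  where
  double-neg : ∀ a → ⌊ a ℤ.+ a ℤ.<? + 0 ⌋ ≡ isNeg a
  double-neg (+ _)     = refl
  double-neg -[1+ _ ] = refl

lenKernel-pair : ∀ {i j} a b → i ≢ j → lenKernel i j a b + lenKernel j i b a ≡ pairInvAt i j a b
lenKernel-pair {i} {j} a b i≢j with <-cmp i j
... | tri≈ _ i≡j _ = contradiction i≡j i≢j
... | tri< i<j _ _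
  rewrite ⌊⌋-true (i ℕ.<? j) i<j | ⌊⌋-true (i ℕ.≤? j) (<⇒≤ i<j)
        | ⌊⌋-false (j ℕ.<? i) (<⇒≯ i<j) | ⌊⌋-false (j ℕ.≤? i) (<⇒≱ i<j)
  = trans (+-identityʳ _) (cong (λ s → 𝟙 ⌊ b ℤ.<? a ⌋ + 𝟙 s) (⌊a+b<0⌋≡⌊b<-a⌋ a b))
... | tri> _ _ j<i
  rewrite ⌊⌋-false (i ℕ.<? j) (<⇒≯ j<i) | ⌊⌋-false (i ℕ.≤? j) (<⇒≱ j<i)
        | ⌊⌋-true (j ℕ.<? i) j<i | ⌊⌋-true (j ℕ.≤? i) (<⇒≤ j<i)
  = cong (λ s → 𝟙 ⌊ a ℤ.<? b ⌋ + 𝟙 s) (⌊a+b<0⌋≡⌊b<-a⌋ b a)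

LKernel-factor : ∀ x y i j a b → x %ℕ 2 ≡ i % 2 → y %ℕ 2 ≡ j % 2 →
  LKernel x y a b ≡ invKernel x y a b * 𝟙 (oppositeParity i j)
LKernel-factor x y i j a b x≡ y≡ rewrite x≡ | y≡ =
  trans (cong 𝟙 (sym (∧-assoc ⌊ x ℤ.<? y ⌋ ⌊ b ℤ.<? a ⌋ (oppositeParity i j))))
        (𝟙-∧ (⌊ x ℤ.<? y ⌋ ∧ ⌊ b ℤ.<? a ⌋) (oppositeParity i j))

orbitSum-LKernel : ∀ i j a b → orbitSum LKernel i j a b ≡ orbitSum invKernel i j a b * 𝟙 (oppositeParity i j)
orbitSum-LKernel i j a b = trans
  (cong₂ _+_ (cong₂ _+_ (LKernel-factor (+ i) (+ j) i j a b refl refl)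
                        (LKernel-factor (+ i) (- + j) i j a (- b) refl (neg-%ℕ2 j)))
             (cong₂ _+_ (LKernel-factor (- + i) (+ j) i j (- a) b (neg-%ℕ2 i) refl)
                        (LKernel-factor (- + i) (- + j) i j (- a) (- b) (neg-%ℕ2 i) (neg-%ℕ2 j))))
  (distrib (invKernel (+ i) (+ j) a b) (invKernel (+ i) (- + j) a (- b))
           (invKernel (- + i) (+ j) (- a) b) (invKernel (- + i) (- + j) (- a) (- b)) (𝟙 (oppositeParity i j)))
  where
  distrib : ∀ p q r s d → (p * d + q * d) + (r * d + s * d) ≡ ((p + q) + (r + s)) * d
  distrib = solve-∀

orbitSum-invKernel : ∀ {i j} a b → 1 ≤ i → 1 ≤ j → i ≢ j → orbitSum invKernel i j a b ≡ pairInvAt i j a b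
orbitSum-invKernel {suc m} {suc m′} a b _ _ i≢j with <-cmp (suc m) (suc m′)
... | tri≈ _ i≡j _ = contradiction i≡j i≢j
... | tri< i<j _ _
  rewrite ⌊⌋-true (+ suc m ℤ.<? + suc m′) (ℤ.+<+ i<j) | ⌊⌋-true (suc m ℕ.<? suc m′) i<j
        | ⌊⌋-false (-[1+ m ] ℤ.<? -[1+ m′ ]) (ℤ.<-asym (neg-mono-< (ℤ.+<+ i<j)))
  = cong₂ _+_ (+-identityʳ (𝟙 ⌊ b ℤ.<? a ⌋)) (+-identityʳ (𝟙 ⌊ b ℤ.<? - a ⌋))
... | tri> _ _ j<i
  rewrite ⌊⌋-false (+ suc m ℤ.<? + suc m′) (ℤ.<-asym (ℤ.+<+ j<i)) | ⌊⌋-false (suc m ℕ.<? suc m′) (<⇒≯ j<i)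
        | ⌊⌋-true (-[1+ m ] ℤ.<? -[1+ m′ ]) (neg-mono-< (ℤ.+<+ j<i))
        | ⌊b<-a⌋≡⌊a<-b⌋ a b | ⌊-b<-a⌋≡⌊a<b⌋ a b
  = +-comm (𝟙 ⌊ a ℤ.<? - b ⌋) _

zeroSum-LKernel : ∀ {i} a → 1 ≤ i → zeroSum LKernel i a ≡ 2 * 𝟙 (isNeg a ∧ oppositeParity 0 i)
zeroSum-LKernel {suc m} a _
  rewrite ⌊-b<-a⌋≡⌊a<b⌋ a (+ 0) | neg-%ℕ2 (suc m) | oppositeParity-sym (suc m) 0
  = twice (𝟙 (isNeg a ∧ oppositeParity 0 (suc m)))
  where
  twice : ∀ x → (x + 0) + (0 + x) ≡ 2 * x
  twice = solve-∀

orbit-diag : ∀ i a b → orbitSum LKernel i i a b ≡ 0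
orbit-diag i a b = begin
  orbitSum LKernel i i a b
    ≡⟨ orbitSum-LKernel i i a b ⟩
  orbitSum invKernel i i a b * 𝟙 (oppositeParity i i)
    ≡⟨ cong (λ d → orbitSum invKernel i i a b * 𝟙 d) (oppositeParity-false {i} {i} refl) ⟩
  orbitSum invKernel i i a b * 0
    ≡⟨ *-zeroʳ (orbitSum invKernel i i a b) ⟩
  0 ∎
  where open ≡-Reasoning

orbit-pair : ∀ {i j} a b → 1 ≤ i → 1 ≤ j → i ≢ j →
  orbitSum LKernel i j a b + orbitSum LKernel j i b a ≡ 2 * (pairInvAt i j a b * 𝟙 (oppositeParity i j))
orbit-pair {i} {j} a b 1≤i 1≤j i≢j = begin
  orbitSum LKernel i j a b + orbitSum LKernel j i b a
    ≡⟨ cong₂ _+_ (orbitSum-LKernel i j a b) (orbitSum-LKernel j i b a) ⟩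
  orbitSum invKernel i j a b * 𝟙 (oppositeParity i j) + orbitSum invKernel j i b a * 𝟙 (oppositeParity j i)
    ≡⟨ cong₂ (λ x y → x * 𝟙 (oppositeParity i j) + y * 𝟙 (oppositeParity j i))
             (orbitSum-invKernel a b 1≤i 1≤j i≢j) (orbitSum-invKernel b a 1≤j 1≤i (≢-sym i≢j)) ⟩
  pairInvAt i j a b * 𝟙 (oppositeParity i j) + pairInvAt j i b a * 𝟙 (oppositeParity j i)
    ≡⟨ cong₂ (λ x d → pairInvAt i j a b * 𝟙 (oppositeParity i j) + x * 𝟙 d)
             (pairInvAt-sym a b i≢j) (oppositeParity-sym j i) ⟩
  pairInvAt i j a b * 𝟙 (oppositeParity i j) + pairInvAt i j a b * 𝟙 (oppositeParity i j)
    ≡⟨ cong (λ s → pairInvAt i j a b * 𝟙 (oppositeParity i j) + s) (+-identityʳ _) ⟨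
  2 * (pairInvAt i j a b * 𝟙 (oppositeParity i j))
    ∎
  where open ≡-Reasoning

len≡∑∑lenKernel : ∀ n w → len n w ≡ ∑∑ (positions n) (λ i j → lenKernel i j (w i) (w j))
len≡∑∑lenKernel n w = begin
  invB n w + nsp n w
    ≡⟨ cong₂ _+_ (count-pairs _ (pos n)) (count-pairs _ (pos n)) ⟩
  ∑∑ (pos n) _ + ∑∑ (pos n) _
    ≡⟨ ∑∑-+ (pos n) _ _ ⟨
  ∑∑ (pos n) (λ i j → lenKernel i j (w i) (w j))
    ≡⟨ ∑∑-↭ _ (pos↭positions n) ⟩
  ∑∑ (positions n) (λ i j → lenKernel i j (w i) (w j)) ∎
  where open ≡-Reasoning

Lstat≡orbitSums : ∀ n w → Lstat n w ≡
  (∑[ i ∈ positions n ] zeroSum LKernel i (w i) + ∑∑ (positions n) (λ i j → orbitSum LKernel i j (w i) (w j))) / 2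
Lstat≡orbitSums n w = cong (_/ 2) (begin
  count Lpred (pairs (symRange n))
    ≡⟨ count-pairs Lpred (symRange n) ⟩
  ∑∑ (symRange n) H
    ≡⟨ ∑∑-↭ H (symRange↭ n) ⟩
  ∑∑ (+ 0 ∷ signed P) H
    ≡⟨ ∑∑-cons (+ 0) (signed P) H ⟩
  ∑[ x ∈ signed P ] (H (+ 0) x + H x (+ 0)) + ∑∑ (signed P) H
    ≡⟨ cong₂ _+_ (∑-signed P _) (∑∑-signed P H) ⟩
  ∑[ i ∈ P ] ((H (+ 0) (+ i) + H (+ i) (+ 0)) + (H (+ 0) (- + i) + H (- + i) (+ 0)))
    + ∑∑ P (λ i j → (H (+ i) (+ j) + H (+ i) (- + j)) + (H (- + i) (+ j) + H (- + i) (- + j)))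
    ≡⟨ cong₂ _+_ (∑-cong P (zero-row ∘ proj₁ ∘ ∈-positions⁻))
                 (∑∑-cong P (λ i∈ j∈ → orbit (proj₁ (∈-positions⁻ i∈)) (proj₁ (∈-positions⁻ j∈)))) ⟩
  ∑[ i ∈ P ] zeroSum LKernel i (w i) + ∑∑ P (λ i j → orbitSum LKernel i j (w i) (w j)) ∎)
  where
  open ≡-Reasoning
  P = positions n
  Lpred : ℤ × ℤ → Bool
  Lpred (x , y) = ⌊ x ℤ.<? y ⌋ ∧ ⌊ ext w y ℤ.<? ext w x ⌋ ∧ not ⌊ x %ℕ 2 ℕ.≟ y %ℕ 2 ⌋
  H : ℤ → ℤ → ℕ
  H x y = LKernel x y (ext w x) (ext w y)
  zero-row : ∀ {i} → 1 ≤ i →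
    (H (+ 0) (+ i) + H (+ i) (+ 0)) + (H (+ 0) (- + i) + H (- + i) (+ 0)) ≡ zeroSum LKernel i (w i)
  zero-row (s≤s _) = refl
  orbit : ∀ {i j} → 1 ≤ i → 1 ≤ j →
    (H (+ i) (+ j) + H (+ i) (- + j)) + (H (- + i) (+ j) + H (- + i) (- + j)) ≡ orbitSum LKernel i j (w i) (w j)
  orbit (s≤s _) (s≤s _) = refl

signSwapF-at : ∀ w t → signSwapF w t t ≡ - w t
signSwapF-at w t with t ℕ.≟ t
... | yes _   = refl
... | no t≢t  = contradiction refl t≢t

signSwapF-other : ∀ w {t c} → c ≢ t → signSwapF w t c ≡ w c
signSwapF-other w {t} {c} c≢t with c ℕ.≟ t
... | yes c≡t = contradiction c≡t c≢t
... | no _    = refl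

twoSwapF-first : ∀ w b t → twoSwapF w b t b ≡ withSignOf (w b) ∣ w t ∣
twoSwapF-first w b t with b ℕ.≟ b
... | yes _   = refl
... | no b≢b  = contradiction refl b≢b

twoSwapF-second : ∀ w {b t} → b ≢ t → twoSwapF w b t t ≡ withSignOf (w t) ∣ w b ∣
twoSwapF-second w {b} {t} b≢t with t ℕ.≟ b | t ℕ.≟ t
... | yes t≡b | _       = contradiction (sym t≡b) b≢t
... | no _    | yes _   = refl
... | no _    | no t≢t  = contradiction refl t≢t

twoSwapF-other : ∀ w {b t c} → c ≢ b → c ≢ t → twoSwapF w b t c ≡ w c
twoSwapF-other w {b} {t} {c} c≢b c≢t with c ℕ.≟ b | c ℕ.≟ t
... | yes c≡b | _       = contradiction c≡b c≢b
... | no _    | yes c≡t = contradiction c≡t c≢t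
... | no _    | no _    = refl

module _ {n : ℕ} (w : SPerm) (perm : IsSignedPerm n w) where

  ∣w∣-injective : ∀ {i j} → InRange n i → InRange n j → i ≢ j → ∣ w i ∣ ≢ ∣ w j ∣
  ∣w∣-injective i∈ j∈ i≢j = i≢j ∘ proj₂ perm _ _ i∈ j∈

  ∣w∣-nonzero : ∀ {i} → InRange n i → ∣ w i ∣ ≢ 0
  ∣w∣-nonzero i∈ ∣wi∣≡0 with () ← subst (1 ≤_) ∣wi∣≡0 (proj₁ (proj₁ perm _ i∈))

module SignSwap {n k : ℕ} {w : SPerm} (perm : IsSignedPerm n w) {t : ℕ} (cond : SignSwapCond n k w t) where

  private
    v : SPerm
    v = signSwapF w t

    t∈ : InRange n t
    t∈ = proj₁ cond

    t-even : t % 2 ≡ 0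
    t-even = proj₁ (proj₂ cond)

    t≤k : t ≤ k
    t≤k = proj₁ (proj₂ (proj₂ cond))

    below-t⇒right-of-k : ∀ c → InRange n c → ∣ w c ∣ < ∣ w t ∣ → k < c
    below-t⇒right-of-k = proj₂ (proj₂ (proj₂ cond))

    split : ∃[ R ] positions n ↭ t ∷ R × (∀ {c} → c ∈ R → InRange n c × c ≢ t)
    split = positions-split₁ t∈

    R = proj₁ split

    rest∈ : ∀ {c} → c ∈ R → InRange n c
    rest∈ c∈R = proj₁ (proj₂ (proj₂ split) c∈R)

    rest≢t : ∀ {c} → c ∈ R → c ≢ t
    rest≢t c∈R = proj₂ (proj₂ (proj₂ split) c∈R)

    rest-unchanged : (κ : ℕ → ℕ → ℤ → ℤ → ℕ) →
      ∑∑ R (λ i j → κ i j (w i) (w j)) ≡ ∑∑ R (λ i j → κ i j (v i) (v j))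
    rest-unchanged κ = ∑∑-cong R (λ c∈R d∈R → sym (cong₂ (κ _ _) (unchanged c∈R) (unchanged d∈R)))
      where
      unchanged : ∀ {c} → c ∈ R → v c ≡ w c
      unchanged c∈R = signSwapF-other w (rest≢t c∈R)

    decompose : (κ : ℕ → ℕ → ℤ → ℤ → ℕ) (u : SPerm) → ∑∑ (positions n) (λ i j → κ i j (u i) (u j)) ≡
      κ t t (u t) (u t) + ∑[ c ∈ R ] (κ t c (u t) (u c) + κ c t (u c) (u t)) + ∑∑ R (λ i j → κ i j (u i) (u j))
    decompose κ u = trans (∑∑-↭ _ (proj₁ (proj₂ split))) (∑∑-cons t R _)

    -- Columns c < t have ∣ w c ∣ > ∣ w t ∣, because rows s < ∣ w t ∣ have j(s) > k ≥ t.
    cross-unchanged : ∀ {c} → c ∈ R → pairInvAt t c (v t) (v c) ≡ pairInvAt t c (w t) (w c)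
    cross-unchanged {c} c∈R rewrite signSwapF-at w t | signSwapF-other w (rest≢t c∈R) =
      pairInvAt-neg t c (w t) (w c) λ t≮c →
        ≤∧≢⇒< (≮⇒≥ λ wc<wt → <-irrefl refl (<-≤-trans (below-t⇒right-of-k c (rest∈ c∈R) wc<wt)
                                                       (≤-trans (≮⇒≥ t≮c) t≤k)))
              (∣w∣-injective w perm t∈ (rest∈ c∈R) (≢-sym (rest≢t c∈R)))

    zeroSum-unchanged : ∀ {i} → i ∈ positions n → zeroSum LKernel i (w i) ≡ zeroSum LKernel i (v i)
    zeroSum-unchanged {i} _ with i ℕ.≟ t
    ... | no _     = refl
    ... | yes refl = begin
      zeroSum LKernel t (w t)
        ≡⟨ zeroSum-LKernel (w t) (proj₁ t∈) ⟩
      2 * 𝟙 (isNeg (w t) ∧ oppositeParity 0 t)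
        ≡⟨ cong (λ d → 2 * 𝟙 (isNeg (w t) ∧ d)) t-not-odd ⟩
      2 * 𝟙 (isNeg (w t) ∧ false)
        ≡⟨ cong (λ s → 2 * 𝟙 s) (trans (∧-zeroʳ (isNeg (w t))) (sym (∧-zeroʳ (isNeg (- w t))))) ⟩
      2 * 𝟙 (isNeg (- w t) ∧ false)
        ≡⟨ cong (λ d → 2 * 𝟙 (isNeg (- w t) ∧ d)) t-not-odd ⟨
      2 * 𝟙 (isNeg (- w t) ∧ oppositeParity 0 t)
        ≡⟨ zeroSum-LKernel (- w t) (proj₁ t∈) ⟨
      zeroSum LKernel t (- w t) ∎
      where
      open ≡-Reasoning
      t-not-odd : oppositeParity 0 t ≡ false
      t-not-odd = oppositeParity-false {0} {t} (sym t-even)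

    orbits-unchanged : ∑∑ (positions n) (λ i j → orbitSum LKernel i j (w i) (w j))
                     ≡ ∑∑ (positions n) (λ i j → orbitSum LKernel i j (v i) (v j))
    orbits-unchanged = begin
      ∑∑ (positions n) (O w)
        ≡⟨ decompose (orbitSum LKernel) w ⟩
      O w t t + ∑[ c ∈ R ] (O w t c + O w c t) + ∑∑ R (O w)
        ≡⟨ cong₂ _+_ (cong₂ _+_ diag (∑-cong R cross)) (rest-unchanged (orbitSum LKernel)) ⟩
      O v t t + ∑[ c ∈ R ] (O v t c + O v c t) + ∑∑ R (O v)
        ≡⟨ decompose (orbitSum LKernel) v ⟨
      ∑∑ (positions n) (O v) ∎
      where
      open ≡-Reasoning
      O : SPerm → ℕ → ℕ → ℕ
      O u i j = orbitSum LKernel i j (u i) (u j)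
      diag : O w t t ≡ O v t t
      diag = trans (orbit-diag t (w t) (w t)) (sym (orbit-diag t (v t) (v t)))
      cross : ∀ {c} → c ∈ R → O w t c + O w c t ≡ O v t c + O v c t
      cross {c} c∈R = begin
        O w t c + O w c t
          ≡⟨ orbit-pair (w t) (w c) (proj₁ t∈) (proj₁ (rest∈ c∈R)) (≢-sym (rest≢t c∈R)) ⟩
        2 * (pairInvAt t c (w t) (w c) * 𝟙 (oppositeParity t c))
          ≡⟨ cong (λ x → 2 * (x * 𝟙 (oppositeParity t c))) (cross-unchanged c∈R) ⟨
        2 * (pairInvAt t c (v t) (v c) * 𝟙 (oppositeParity t c))
          ≡⟨ orbit-pair (v t) (v c) (proj₁ t∈) (proj₁ (rest∈ c∈R)) (≢-sym (rest≢t c∈R)) ⟨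
        O v t c + O v c t ∎

  Lstat-preserved : Lstat n w ≡ Lstat n v
  Lstat-preserved = begin
    Lstat n w
      ≡⟨ Lstat≡orbitSums n w ⟩
    (∑[ i ∈ positions n ] zeroSum LKernel i (w i) + _) / 2
      ≡⟨ cong₂ (λ z o → (z + o) / 2) (∑-cong (positions n) zeroSum-unchanged) orbits-unchanged ⟩
    (∑[ i ∈ positions n ] zeroSum LKernel i (v i) + _) / 2
      ≡⟨ Lstat≡orbitSums n v ⟨
    Lstat n v ∎
    where open ≡-Reasoning

  len-parity-flips : parity (len n w) ≡ parity (len n v) ⁻¹
  len-parity-flips = begin
    parity (len n w)
      ≡⟨ cong parity (trans (len≡∑∑lenKernel n w) (decompose lenKernel w)) ⟩
    parity (D w + C w + Rest w)
      ≡⟨ parity-+-flip (D w + C w) (D v + C v) (Rest w) (Rest v)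
           (parity-+-flip (D w) (D v) (C w) (C v) diag (cong parity (∑-cong R cross)))
           (cong parity (rest-unchanged lenKernel)) ⟩
    parity (D v + C v + Rest v) ⁻¹
      ≡⟨ cong (λ m → parity m ⁻¹) (trans (len≡∑∑lenKernel n v) (decompose lenKernel v)) ⟨
    parity (len n v) ⁻¹ ∎
    where
    open ≡-Reasoning
    K : SPerm → ℕ → ℕ → ℕ
    K u i j = lenKernel i j (u i) (u j)
    D C Rest : SPerm → ℕ
    D u = K u t t
    C u = ∑[ c ∈ R ] (K u t c + K u c t)
    Rest u = ∑∑ R (K u)
    diag : parity (K w t t) ≡ parity (K v t t) ⁻¹
    diag = begin
      parity (K w t t)                     ≡⟨ cong parity (lenKernel-diag t (w t)) ⟩
      parity (𝟙 (isNeg (w t)))             ≡⟨ 𝟙-parity-not (isNeg (w t)) ⟩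
      parity (𝟙 (not (isNeg (w t)))) ⁻¹    ≡⟨ cong (λ s → parity (𝟙 s) ⁻¹) (isNeg-neg wt≢0) ⟨
      parity (𝟙 (isNeg (- w t))) ⁻¹        ≡⟨ cong (λ a → parity (𝟙 (isNeg a)) ⁻¹) (signSwapF-at w t) ⟨
      parity (𝟙 (isNeg (v t))) ⁻¹          ≡⟨ cong (λ m → parity m ⁻¹) (lenKernel-diag t (v t)) ⟨
      parity (K v t t) ⁻¹                  ∎
      where
      wt≢0 : w t ≢ + 0
      wt≢0 wt≡0 = ∣w∣-nonzero w perm t∈ (cong ∣_∣ wt≡0)
    cross : ∀ {c} → c ∈ R → K w t c + K w c t ≡ K v t c + K v c t
    cross {c} c∈R = begin
      K w t c + K w c t                 ≡⟨ lenKernel-pair (w t) (w c) (≢-sym (rest≢t c∈R)) ⟩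
      pairInvAt t c (w t) (w c)         ≡⟨ cross-unchanged c∈R ⟨
      pairInvAt t c (v t) (v c)         ≡⟨ lenKernel-pair (v t) (v c) (≢-sym (rest≢t c∈R)) ⟨
      K v t c + K v c t                 ∎

  swapping-lemma : Lstat n w ≡ Lstat n v × sgn n w ≡ - sgn n v
  swapping-lemma = Lstat-preserved , sgn-flip n w v len-parity-flips

-- What each of the five kinds of two swap guarantees, and all that is needed to keep L unchanged.
TwoSwapCompatible : ℕ → SPerm → ℕ → ℕ → Set
TwoSwapCompatible n w b t = ∀ c → InRange n c → StrictlyBetween (∣ w b ∣) (∣ w t ∣) (∣ w c ∣) →
  (c < b → isNeg (w b) ≡ isNeg (w t)) × (b < c → c < t → isNeg (w c) ≡ not (isNeg (w t)))

module TwoSwap {n k : ℕ} {w : SPerm} (perm : IsSignedPerm n w) {b t : ℕ} (cond : TwoSwapCond n k w b t) where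

  private
    v : SPerm
    v = twoSwapF w b t

    b<t : b < t
    b<t = proj₁ (proj₂ cond)

    b≢t : b ≢ t
    b≢t = <⇒≢ b<t

    b∈ : InRange n b
    b∈ = proj₁ cond , ≤-trans (<⇒≤ b<t) (proj₁ (proj₂ (proj₂ cond)))

    t∈ : InRange n t
    t∈ = ≤-trans (proj₁ cond) (<⇒≤ b<t) , proj₁ (proj₂ (proj₂ cond))

    same-parity : b % 2 ≡ t % 2
    same-parity = proj₁ (proj₂ (proj₂ (proj₂ cond)))

    split : ∃[ R ] positions n ↭ b ∷ t ∷ R × (∀ {c} → c ∈ R → InRange n c × c ≢ b × c ≢ t)
    split = positions-split₂ b∈ t∈ b≢t

    R = proj₁ split

    rest∈ : ∀ {c} → c ∈ R → InRange n c
    rest∈ c∈R = proj₁ (proj₂ (proj₂ split) c∈R)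

    rest≢b : ∀ {c} → c ∈ R → c ≢ b
    rest≢b c∈R = proj₁ (proj₂ (proj₂ (proj₂ split) c∈R))

    rest≢t : ∀ {c} → c ∈ R → c ≢ t
    rest≢t c∈R = proj₂ (proj₂ (proj₂ (proj₂ split) c∈R))

    X Y : ℕ
    X = ∣ w b ∣
    Y = ∣ w t ∣

    X≢Y : X ≢ Y
    X≢Y = ∣w∣-injective w perm b∈ t∈ b≢t

    ∣v-b∣ : ∣ v b ∣ ≡ Y
    ∣v-b∣ = trans (cong ∣_∣ (twoSwapF-first w b t)) (∣withSignOf∣ (w b) Y)

    ∣v-t∣ : ∣ v t ∣ ≡ X
    ∣v-t∣ = trans (cong ∣_∣ (twoSwapF-second w b≢t)) (∣withSignOf∣ (w t) X)

    isNeg-v-b : isNeg (v b) ≡ isNeg (w b)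
    isNeg-v-b = trans (cong isNeg (twoSwapF-first w b t)) (isNeg-withSignOf (w b) (∣w∣-nonzero w perm t∈))

    isNeg-v-t : isNeg (v t) ≡ isNeg (w t)
    isNeg-v-t = trans (cong isNeg (twoSwapF-second w b≢t)) (isNeg-withSignOf (w t) (∣w∣-nonzero w perm b∈))

    isNeg-v : ∀ i → isNeg (v i) ≡ isNeg (w i)
    isNeg-v i with i ℕ.≟ b | i ℕ.≟ t
    ... | yes refl | _        = isNeg-withSignOf (w b) (∣w∣-nonzero w perm t∈)
    ... | no _     | yes refl = isNeg-withSignOf (w t) (∣w∣-nonzero w perm b∈)
    ... | no _     | no _     = refl

    v≡w-off-bt : ∀ {c} → c ∈ R → v c ≡ w c
    v≡w-off-bt c∈R = twoSwapF-other w (rest≢b c∈R) (rest≢t c∈R)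

    rest-unchanged : (κ : ℕ → ℕ → ℤ → ℤ → ℕ) →
      ∑∑ R (λ i j → κ i j (w i) (w j)) ≡ ∑∑ R (λ i j → κ i j (v i) (v j))
    rest-unchanged κ = ∑∑-cong R (λ c∈R d∈R → sym (cong₂ (κ _ _) (v≡w-off-bt c∈R) (v≡w-off-bt d∈R)))

    block cross : (κ : ℕ → ℕ → ℤ → ℤ → ℕ) (u : SPerm) → ℕ
    crossTerm : (κ : ℕ → ℕ → ℤ → ℤ → ℕ) (u : SPerm) → ℕ → ℕ
    block κ u = κ b b (u b) (u b) + κ t t (u t) (u t) + (κ b t (u b) (u t) + κ t b (u t) (u b))
    crossTerm κ u c = (κ b c (u b) (u c) + κ c b (u c) (u b)) + (κ t c (u t) (u c) + κ c t (u c) (u t))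
    cross κ u = ∑[ c ∈ R ] crossTerm κ u c

    decompose : (κ : ℕ → ℕ → ℤ → ℤ → ℕ) (u : SPerm) →
      ∑∑ (positions n) (λ i j → κ i j (u i) (u j)) ≡ block κ u + cross κ u + ∑∑ R (λ i j → κ i j (u i) (u j))
    decompose κ u = trans (∑∑-↭ _ (proj₁ (proj₂ split))) (∑∑-cons₂ b t R _)

    pairInvsAt : SPerm → ℕ → ℕ
    pairInvsAt u c = pairInvAt b c (u b) (u c) + pairInvAt t c (u t) (u c)

    module AtOther {c : ℕ} (c∈R : c ∈ R) where

      Z : ℕ
      Z = ∣ w c ∣

      Z≢X : Z ≢ X
      Z≢X = ∣w∣-injective w perm (rest∈ c∈R) b∈ (rest≢b c∈R)

      Z≢Y : Z ≢ Y
      Z≢Y = ∣w∣-injective w perm (rest∈ c∈R) t∈ (rest≢t c∈R)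

      bc tc : Bool
      bc = ⌊ b ℕ.<? c ⌋
      tc = ⌊ t ℕ.<? c ⌋

      shape : Bool → Bool → ℕ
      shape x y = pairInvShape bc x (isNeg (w b)) (isNeg (w c)) + pairInvShape tc y (isNeg (w t)) (isNeg (w c))

      shape-w : pairInvsAt w c ≡ shape ⌊ X ℕ.<? Z ⌋ ⌊ Y ℕ.<? Z ⌋
      shape-w = cong₂ _+_ (pairInvAt-shape b c (w b) (w c) (≢-sym Z≢X)) (pairInvAt-shape t c (w t) (w c) (≢-sym Z≢Y))

      shape-v : pairInvsAt v c ≡ shape ⌊ Y ℕ.<? Z ⌋ ⌊ X ℕ.<? Z ⌋
      shape-v = begin
        pairInvAt b c (v b) (v c) + pairInvAt t c (v t) (v c)
          ≡⟨ cong (λ z → pairInvAt b c (v b) z + pairInvAt t c (v t) z) (v≡w-off-bt c∈R) ⟩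
        pairInvAt b c (v b) (w c) + pairInvAt t c (v t) (w c)
          ≡⟨ cong₂ _+_ (pairInvAt-shape b c (v b) (w c) (λ e → Z≢Y (sym (trans (sym ∣v-b∣) e))))
                       (pairInvAt-shape t c (v t) (w c) (λ e → Z≢X (sym (trans (sym ∣v-t∣) e)))) ⟩
        pairInvShape bc ⌊ ∣ v b ∣ ℕ.<? Z ⌋ (isNeg (v b)) (isNeg (w c))
          + pairInvShape tc ⌊ ∣ v t ∣ ℕ.<? Z ⌋ (isNeg (v t)) (isNeg (w c))
          ≡⟨ cong₂ _+_ (cong₂ (λ m s → pairInvShape bc ⌊ m ℕ.<? Z ⌋ s (isNeg (w c))) ∣v-b∣ isNeg-v-b)
                       (cong₂ (λ m s → pairInvShape tc ⌊ m ℕ.<? Z ⌋ s (isNeg (w c))) ∣v-t∣ isNeg-v-t) ⟩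
        shape ⌊ Y ℕ.<? Z ⌋ ⌊ X ℕ.<? Z ⌋
          ∎
        where open ≡-Reasoning

      c-left-of-b⇒left-of-t : bc ≡ false → tc ≡ false
      c-left-of-b⇒left-of-t b≮c = ⌊⌋-false (t ℕ.<? c) (λ t<c → ⌊⌋-false⁻¹ b≮c (<-trans b<t t<c))

      pairs-parity : parity (pairInvsAt w c) ≡ parity (pairInvsAt v c)
      pairs-parity = trans (cong parity shape-w)
        (trans (pairInvShape-exchange-parity bc tc _ _ (isNeg (w b)) (isNeg (w t)) (isNeg (w c)) c-left-of-b⇒left-of-t)
               (cong parity (sym shape-v)))

      pairs-unchanged : TwoSwapCompatible n w b t → pairInvsAt w c ≡ pairInvsAt v c
      pairs-unchanged compat = trans shape-w
        (trans (pairInvShape-exchange bc tc _ _ (isNeg (w b)) (isNeg (w t)) (isNeg (w c)) c-left-of-b⇒left-of-t signs)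
               (sym shape-v))
        where
        signs : ⌊ X ℕ.<? Z ⌋ ≢ ⌊ Y ℕ.<? Z ⌋ →
          (bc ≡ false → isNeg (w b) ≡ isNeg (w t)) × (bc ≡ true → tc ≡ false → isNeg (w c) ≡ not (isNeg (w t)))
        signs sides≢ with left , middle ← compat c (rest∈ c∈R) (⌊<?⌋≢⇒strictlyBetween Z≢X Z≢Y sides≢) =
          (λ b≮c → left (≤∧≢⇒< (≮⇒≥ (⌊⌋-false⁻¹ b≮c)) (rest≢b c∈R))) ,
          (λ b<c t≮c → middle (⌊⌋-true⁻¹ b<c) (≤∧≢⇒< (≮⇒≥ (⌊⌋-false⁻¹ t≮c)) (rest≢t c∈R)))

    block-orbits : ∀ u → block (orbitSum LKernel) u ≡ 0
    block-orbits u = cong₂ _+_ (cong₂ _+_ (orbit-diag b (u b) (u b)) (orbit-diag t (u t) (u t))) (begin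
      orbitSum LKernel b t (u b) (u t) + orbitSum LKernel t b (u t) (u b)
        ≡⟨ orbit-pair (u b) (u t) (proj₁ b∈) (proj₁ t∈) b≢t ⟩
      2 * (pairInvAt b t (u b) (u t) * 𝟙 (oppositeParity b t))
        ≡⟨ cong (λ d → 2 * (pairInvAt b t (u b) (u t) * 𝟙 d)) (oppositeParity-false {b} {t} same-parity) ⟩
      2 * (pairInvAt b t (u b) (u t) * 0)
        ≡⟨ cong (2 *_) (*-zeroʳ (pairInvAt b t (u b) (u t))) ⟩
      0 ∎)
      where open ≡-Reasoning

    cross-orbits : ∀ u {c} → c ∈ R → crossTerm (orbitSum LKernel) u c ≡ 2 * (pairInvsAt u c * 𝟙 (oppositeParity b c))
    cross-orbits u {c} c∈R = begin
      _ ≡⟨ cong₂ _+_ (orbit-pair (u b) (u c) (proj₁ b∈) (proj₁ (rest∈ c∈R)) (≢-sym (rest≢b c∈R)))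
                     (orbit-pair (u t) (u c) (proj₁ t∈) (proj₁ (rest∈ c∈R)) (≢-sym (rest≢t c∈R))) ⟩
      2 * (pairInvAt b c (u b) (u c) * 𝟙 (oppositeParity b c)) + 2 * (pairInvAt t c (u t) (u c) * 𝟙 (oppositeParity t c))
        ≡⟨ cong (λ d → 2 * (pairInvAt b c (u b) (u c) * 𝟙 (oppositeParity b c)) + 2 * (pairInvAt t c (u t) (u c) * 𝟙 d))
                (cong (λ p → not ⌊ p ℕ.≟ c % 2 ⌋) (sym same-parity)) ⟩
      2 * (pairInvAt b c (u b) (u c) * 𝟙 (oppositeParity b c)) + 2 * (pairInvAt t c (u t) (u c) * 𝟙 (oppositeParity b c))
        ≡⟨ factor (pairInvAt b c (u b) (u c)) (pairInvAt t c (u t) (u c)) (𝟙 (oppositeParity b c)) ⟩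
      2 * (pairInvsAt u c * 𝟙 (oppositeParity b c)) ∎
      where
      open ≡-Reasoning
      factor : ∀ x y d → 2 * (x * d) + 2 * (y * d) ≡ 2 * ((x + y) * d)
      factor = solve-∀

    cross-lens : ∀ u {c} → c ∈ R → crossTerm lenKernel u c ≡ pairInvsAt u c
    cross-lens u c∈R =
      cong₂ _+_ (lenKernel-pair (u b) _ (≢-sym (rest≢b c∈R))) (lenKernel-pair (u t) _ (≢-sym (rest≢t c∈R)))

    block-lens-flip : parity (block lenKernel w) ≡ parity (block lenKernel v) ⁻¹
    block-lens-flip = begin
      parity (block lenKernel w)
        ≡⟨ cong parity (block-lens w) ⟩
      parity (pairInvAt b t (w b) (w t) + signs w)
        ≡⟨ parity-+-flip (pairInvAt b t (w b) (w t)) (pairInvAt b t (v b) (v t)) (signs w) (signs v)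
             (pairInvAt-exchange-parity b t {w b} {w t} {v b} {v t} X≢Y ∣v-b∣ ∣v-t∣) (cong parity (sym signs-v)) ⟩
      parity (pairInvAt b t (v b) (v t) + signs v) ⁻¹
        ≡⟨ cong (λ m → parity m ⁻¹) (block-lens v) ⟨
      parity (block lenKernel v) ⁻¹ ∎
      where
      open ≡-Reasoning
      signs : SPerm → ℕ
      signs u = 𝟙 (isNeg (u b)) + 𝟙 (isNeg (u t))
      signs-v : signs v ≡ signs w
      signs-v = cong₂ (λ p q → 𝟙 p + 𝟙 q) isNeg-v-b isNeg-v-t
      block-lens : ∀ u → block lenKernel u ≡ pairInvAt b t (u b) (u t) + signs u
      block-lens u =
        trans (cong₂ _+_ (cong₂ _+_ (lenKernel-diag b (u b)) (lenKernel-diag t (u t))) (lenKernel-pair (u b) (u t) b≢t))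
              (+-comm (signs u) _)

  len-parity-flips : parity (len n w) ≡ parity (len n v) ⁻¹
  len-parity-flips = begin
    parity (len n w)
      ≡⟨ cong parity (trans (len≡∑∑lenKernel n w) (decompose lenKernel w)) ⟩
    parity (D w + C w + Rest w)
      ≡⟨ parity-+-flip (D w + C w) (D v + C v) (Rest w) (Rest v)
           (parity-+-flip (D w) (D v) (C w) (C v) block-lens-flip
             (∑-parity R {crossTerm lenKernel w} {crossTerm lenKernel v} cross-parity))
           (cong parity (rest-unchanged lenKernel)) ⟩
    parity (D v + C v + Rest v) ⁻¹
      ≡⟨ cong (λ m → parity m ⁻¹) (trans (len≡∑∑lenKernel n v) (decompose lenKernel v)) ⟨
    parity (len n v) ⁻¹ ∎
    where
    open ≡-Reasoning
    D C Rest : SPerm → ℕ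
    D = block lenKernel
    C = cross lenKernel
    Rest u = ∑∑ R (λ i j → lenKernel i j (u i) (u j))
    cross-parity : ∀ {c} → c ∈ R → parity (crossTerm lenKernel w c) ≡ parity (crossTerm lenKernel v c)
    cross-parity c∈R = trans (cong parity (cross-lens w c∈R))
                             (trans (AtOther.pairs-parity c∈R) (cong parity (sym (cross-lens v c∈R))))

  Lstat-preserved : TwoSwapCompatible n w b t → Lstat n w ≡ Lstat n v
  Lstat-preserved compat = begin
    Lstat n w
      ≡⟨ Lstat≡orbitSums n w ⟩
    (∑[ i ∈ positions n ] zeroSum LKernel i (w i) + O w) / 2
      ≡⟨ cong₂ (λ z o → (z + o) / 2) (∑-cong (positions n) zeros) orbits ⟩
    (∑[ i ∈ positions n ] zeroSum LKernel i (v i) + O v) / 2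
      ≡⟨ Lstat≡orbitSums n v ⟨
    Lstat n v ∎
    where
    open ≡-Reasoning
    O : SPerm → ℕ
    O u = ∑∑ (positions n) (λ i j → orbitSum LKernel i j (u i) (u j))
    zeros : ∀ {i} → i ∈ positions n → zeroSum LKernel i (w i) ≡ zeroSum LKernel i (v i)
    zeros {i} i∈ = trans (zeroSum-LKernel (w i) 1≤i)
      (trans (cong (λ s → 2 * 𝟙 (s ∧ oppositeParity 0 i)) (sym (isNeg-v i))) (sym (zeroSum-LKernel (v i) 1≤i)))
      where 1≤i = proj₁ (∈-positions⁻ i∈)
    cross-eq : ∀ {c} → c ∈ R → crossTerm (orbitSum LKernel) w c ≡ crossTerm (orbitSum LKernel) v c
    cross-eq {c} c∈R = trans (cross-orbits w c∈R)
      (trans (cong (λ p → 2 * (p * 𝟙 (oppositeParity b c))) (AtOther.pairs-unchanged c∈R compat))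
             (sym (cross-orbits v c∈R)))
    orbits : O w ≡ O v
    orbits = begin
      O w
        ≡⟨ decompose (orbitSum LKernel) w ⟩
      block (orbitSum LKernel) w + cross (orbitSum LKernel) w + _
        ≡⟨ cong₂ _+_ (cong₂ _+_ (trans (block-orbits w) (sym (block-orbits v)))
                                (∑-cong R cross-eq))
                    (rest-unchanged (orbitSum LKernel)) ⟩
      block (orbitSum LKernel) v + cross (orbitSum LKernel) v + _
        ≡⟨ decompose (orbitSum LKernel) v ⟨
      O v ∎

  swapping-lemma : TwoSwapCompatible n w b t → Lstat n w ≡ Lstat n v × sgn n w ≡ - sgn n v
  swapping-lemma compat = Lstat-preserved compat , sgn-flip n w v len-parity-flips

module _ {n k : ℕ} {w : SPerm} {b t : ℕ} (cond : TwoSwapCond n k w b t) where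

  private
    b<t : b < t
    b<t = proj₁ (proj₂ cond)

    right-of-k : ∀ c → InRange n c → StrictlyBetween (∣ w b ∣) (∣ w t ∣) (∣ w c ∣) → k < c
    right-of-k = proj₂ (proj₂ (proj₂ (proj₂ cond)))

    not-left-of : ∀ {c j} → k < c → j ≤ k → ¬ c < j
    not-left-of k<c j≤k c<j = <-irrefl refl (<-≤-trans (<-trans k<c c<j) j≤k)

  leftSwap-compatible : t ≤ k → TwoSwapCompatible n w b t
  leftSwap-compatible t≤k c c∈ between =
    (λ c<b → contradiction (<-trans c<b b<t) (not-left-of k<c t≤k)) , (λ _ c<t → contradiction c<t (not-left-of k<c t≤k))
    where k<c = right-of-k c c∈ between

  doubleMinus-compatible : Neg (w b) → Neg (w t) → BetweenSigns n Pos w b t → TwoSwapCompatible n w b t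
  doubleMinus-compatible wb<0 wt<0 pos c c∈ between =
    (λ _ → trans (isNeg-Neg wb<0) (sym (isNeg-Neg wt<0))) ,
    (λ _ _ → trans (isNeg-Pos (pos c c∈ between)) (cong not (sym (isNeg-Neg wt<0))))

  singleMinus-compatible : Neg (w t) → b ≤ k → BetweenSigns n Pos w b t → TwoSwapCompatible n w b t
  singleMinus-compatible wt<0 b≤k pos c c∈ between =
    (λ c<b → contradiction c<b (not-left-of (right-of-k c c∈ between) b≤k)) ,
    (λ _ _ → trans (isNeg-Pos (pos c c∈ between)) (cong not (sym (isNeg-Neg wt<0))))

  doublePlus-compatible : Pos (w b) → Pos (w t) → BetweenSigns n Neg w b t → TwoSwapCompatible n w b t
  doublePlus-compatible 0<wb 0<wt neg c c∈ between =
    (λ _ → trans (isNeg-Pos 0<wb) (sym (isNeg-Pos 0<wt))) ,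
    (λ _ _ → trans (isNeg-Neg (neg c c∈ between)) (cong not (sym (isNeg-Pos 0<wt))))

  singlePlus-compatible : Pos (w t) → b ≤ k → BetweenSigns n Neg w b t → TwoSwapCompatible n w b t
  singlePlus-compatible 0<wt b≤k neg c c∈ between =
    (λ c<b → contradiction c<b (not-left-of (right-of-k c c∈ between) b≤k)) ,
    (λ _ _ → trans (isNeg-Neg (neg c c∈ between)) (cong not (sym (isNeg-Pos 0<wt))))

lemma5p18 : (n : ℕ) → 1 ≤ n → (I : ℕ → Set) → (∀ i → I i → i < n) →
    (k : ℕ) → 1 ≤ k → k ≤ n → (w : SPerm) → InCI n I w →
    (x : Swap n k w) →
    Lstat n w ≡ Lstat n (swap x) × sgn n w ≡ - sgn n (swap x)
lemma5p18 _ _ _ _ _ _ _ w (perm , _ , _) (signSwap t cond) =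
  SignSwap.swapping-lemma perm cond
lemma5p18 _ _ _ _ _ _ _ w (perm , _ , _) (leftSwap b t cond t≤k) =
  TwoSwap.swapping-lemma perm cond (leftSwap-compatible cond t≤k)
lemma5p18 _ _ _ _ _ _ _ w (perm , _ , _) (doubleMinus b t cond wb<0 wt<0 _ pos) =
  TwoSwap.swapping-lemma perm cond (doubleMinus-compatible cond wb<0 wt<0 pos)
lemma5p18 _ _ _ _ _ _ _ w (perm , _ , _) (singleMinus b t cond wt<0 b≤k _ pos) =
  TwoSwap.swapping-lemma perm cond (singleMinus-compatible cond wt<0 b≤k pos)
lemma5p18 _ _ _ _ _ _ _ w (perm , _ , _) (doublePlus b t cond 0<wb 0<wt _ neg) =
  TwoSwap.swapping-lemma perm cond (doublePlus-compatible cond 0<wb 0<wt neg)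
lemma5p18 _ _ _ _ _ _ _ w (perm , _ , _) (singlePlus b t cond 0<wt b≤k _ neg) =
  TwoSwap.swapping-lemma perm cond (singlePlus-compatible cond 0<wt b≤k neg)
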